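{- Let $G$ be a finite simple bipartite graph with $e$ edges whose two colour classes each have $v$ vertices. If the girth of $G$ is at least $8$, then $$e<v^{4/3}+\tfrac{2}{3}v-\tfrac{2}{9}v^{2/3}-\tfrac{20}{81}v^{1/3}.$$
   Context: The girth of a graph is the length of its shortest cycle (infinite if there is none). -}

module Defs where

open import Data.Nat as ℕ using (ℕ; zero; suc; _≤_; _<_)
open import Data.Integer using (+_)
open import Data.Rational as ℚ using (ℚ; _/_; _*_; _+_; _-_)
open import Data.Fin using (Fin; zero; suc; inject₁; fromℕ)
open import Data.Bool using (Bool; true; false; if_then_else_)
open import Data.Sum using (_⊎_; inj₁; inj₂)
open import Data.Empty using (⊥)
open import Data.List using (List; map; allFin)
open import Data.Nat.ListAction using (sum)
open import Data.Product using (Σ; _×_)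
open import Function.Definitions using (Injective)
open import Relation.Nullary using (¬_)
open import Relation.Binary.PropositionalEquality using (_≡_)

record SimpleGraph (V : Set) : Set₁ where
  field
    Adj    : V → V → Set
    sym    : ∀ {x y} → Adj x y → Adj y x
    irrefl : ∀ {x} → ¬ Adj x x
open SimpleGraph public

-- A cycle of length (suc n) in G: pairwise distinct vertices c 0, …, c n
-- with c i ~ c (i+1) and c n ~ c 0.  Only meaningful for length ≥ 3.
record Cycle {V : Set} (G : SimpleGraph V) (n : ℕ) : Set where
  field
    vtx      : Fin (suc n) → V
    distinct : Injective _≡_ _≡_ vtx
    step     : (i : Fin n) → Adj G (vtx (inject₁ i)) (vtx (suc i))
    close    : Adj G (vtx (fromℕ n)) (vtx zero)

-- "girth G ≥ g": G has no cycle of length k with 3 ≤ k < g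
-- (the girth is the length of a shortest cycle, ∞ if none).
GirthAtLeast : {V : Set} → SimpleGraph V → ℕ → Set
GirthAtLeast G g = ∀ n → 3 ≤ suc n → suc n < g → ¬ Cycle G n

-- Bipartite graph with colour classes Fin v and Fin v, given by a
-- bi-adjacency relation R (R a b ≡ true iff a in class 1 ~ b in class 2).
BipAdj : ∀ {v} → (Fin v → Fin v → Bool) → Fin v ⊎ Fin v → Fin v ⊎ Fin v → Set
BipAdj R (inj₁ a) (inj₂ b) = R a b ≡ true
BipAdj R (inj₂ b) (inj₁ a) = R a b ≡ true
BipAdj R (inj₁ _) (inj₁ _) = ⊥
BipAdj R (inj₂ _) (inj₂ _) = ⊥

bipSym : ∀ {v} (R : Fin v → Fin v → Bool) {x y} → BipAdj R x y → BipAdj R y x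
bipSym R {inj₁ a} {inj₂ b} p = p
bipSym R {inj₂ b} {inj₁ a} p = p

bipIrrefl : ∀ {v} (R : Fin v → Fin v → Bool) {x} → ¬ BipAdj R x x
bipIrrefl R {inj₁ _} ()
bipIrrefl R {inj₂ _} ()

bipGraph : ∀ {v} → (Fin v → Fin v → Bool) → SimpleGraph (Fin v ⊎ Fin v)
bipGraph R = record { Adj = BipAdj R ; sym = bipSym R ; irrefl = bipIrrefl R }

edgeCount : ∀ v → (Fin v → Fin v → Bool) → ℕ
edgeCount v R =
  sum (map (λ a → sum (map (λ b → if R a b then 1 else 0) (allFin v))) (allFin v))

-- f(q) = q^4 + (2/3) q^3 - (2/9) q^2 - (20/81) q ; the bound is f(v^{1/3})
bound : ℚ → ℚ
bound q = q * q * q * q + (+ 2 / 3) * (q * q * q)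
          - (+ 2 / 9) * (q * q) - (+ 20 / 81) * q

-- e < f(v^{1/3})  (real cube root), expressed without reals:
-- there is a rational q ≥ 0 with q³ ≤ v and e < f(q).
-- (Equivalent, since f is increasing wherever f > 0 on [0,∞), and f continuous.)
BelowBoundAtCubeRoot : ℕ → ℕ → Set
BelowBoundAtCubeRoot e v =
  Σ ℚ λ q → (ℚ.0ℚ ℚ.≤ q) × (q * q * q ℚ.≤ (+ v / 1)) × ((+ e / 1) ℚ.< bound q)

-- Write e = v + w for the number of edges and d for degrees. As the girth is at least 8, a vertex a of one
-- colour class and a vertex b′ of the other are joined by at most one path of length 1 or 3, so
-- e + Σ_{ab edge} (d_a − 1)(d_b − 1) ≤ v². A tangent-plane inequality at d_a = d_b = e/v, weighted by 1/d_a and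
-- 1/d_b (which sum to at most v over the edges), bounds that sum below by e w²/v². Hence e (v² + w²) ≤ v⁴,
-- i.e. ψ(e/v) ≤ v for the increasing cubic ψ(r) = r³ − 2r² + 2r; leaves and very sparse graphs need separate
-- care. Finally take q = k/N with k³ ≤ vN³ < (k + 1)³ and κ = (k + 1)/N, and let f be the claimed bound. The
-- expansion ψ(q + 2/3 − u) = q³ + u (20/(27q) − u²), u = 2/(9q) + 20/(81q²), gives ψ(f(q)/κ³) ≥ κ³ > v once
-- N is large, so e/v < f(q)/κ³ by monotonicity and e < f(q).

module Submission where

open import Defs using (GirthAtLeast; bipGraph; edgeCount; bound; BelowBoundAtCubeRoot)
open import Data.Bool using (Bool; true; false; if_then_else_)
open import Data.Empty using (⊥)
open import Data.Fin using (Fin; zero; suc)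
import Data.Fin as Fin
import Data.Fin.Properties as Fin
import Data.Integer as ℤ
import Data.Integer.Properties as ℤ
import Data.List as List using (map; allFin; tabulate)
import Data.List.Properties as List
open import Data.Nat
open import Data.Nat.Properties
open import Data.Nat.Divisibility using (∣-trans; m∣m*n; m≤n⇒m!∣n!)
open import Data.Nat.DivMod using (_/_; m/n*n≡m)
import Data.Nat.ListAction as List
open import Data.Nat.Tactic.RingSolver using (solve-∀)
open import Data.Product using (Σ; ∃-syntax; _×_; _,_)
import Data.Rational as ℚ
import Data.Rational.Properties as ℚ
open import Data.Rational.Solver using (module +-*-Solver)
open import Data.Rational.Unnormalised as ℚᵘ using (mkℚᵘ; *<*; *≤*)
import Data.Rational.Unnormalised.Properties as ℚᵘ
open import Data.Sum using (_⊎_; inj₁; inj₂)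
import Data.Sum.Properties as Sum
open import Data.Vec using (_∷_; []; lookup)
open import Data.Vec.Relation.Unary.All using (_∷_; [])
open import Data.Vec.Relation.Unary.AllPairs using (_∷_; [])
open import Data.Vec.Relation.Unary.Unique.Propositional.Properties using (lookup-injective)
open import Function using (_∘_)
open import Relation.Binary.PropositionalEquality
open import Relation.Nullary using (Dec; yes; no; contradiction)
open import Relation.Nullary.Decidable using (does; from-yes; _×-dec_; _⊎-dec_)
open import Algebra.Properties.Semiring.Sum +-*-semiring
  using (sum-syntax; sum-cong-≗; ∑-distrib-+; ∑-comm; *-distribˡ-sum; *-distribʳ-sum)

-- The cubic ψ

m+o≡n⇒m≤n : ∀ {m n} o → m + o ≡ n → m ≤ n
m+o≡n⇒m≤n {m} o eq = subst (m ≤_) eq (m≤m+n m o)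

2mn≤m²+n² : ∀ m n → 2 * (m * n) ≤ m * m + n * n
2mn≤m²+n² m n with ≤-total m n
... | inj₁ m≤n with m≤n⇒∃[o]m+o≡n m≤n
...   | t , refl = m+o≡n⇒m≤n (t * t) (square m t)
  where
  square : ∀ m t → 2 * (m * (m + t)) + t * t ≡ m * m + (m + t) * (m + t)
  square = solve-∀
2mn≤m²+n² m n | inj₂ n≤m with m≤n⇒∃[o]m+o≡n n≤m
...   | t , refl = m+o≡n⇒m≤n (t * t) (square n t)
  where
  square : ∀ n t → 2 * ((n + t) * n) + t * t ≡ (n + t) * (n + t) + n * n
  square = solve-∀

-- y³ ψ(x/y) = ψ⁺ x y − ψ⁻ x y for ψ(r) = r³ − 2r² + 2r = r ((r − 1)² + 1), split to stay in ℕ.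
ψ⁺ ψ⁻ : ℕ → ℕ → ℕ
ψ⁺ x y = x * x * x + 2 * x * y * y
ψ⁻ x y = 2 * x * x * y

ψ-mono : ∀ {x x′} y → x ≤ x′ → ψ⁺ x y + ψ⁻ x′ y ≤ ψ⁺ x′ y + ψ⁻ x y
ψ-mono {x} y x≤x′ with m≤n⇒∃[o]m+o≡n x≤x′
... | t , refl = +-cancelʳ-≤ (t * rise⁻) _ _ (begin
    ψ⁺ x y + ψ⁻ (x + t) y + t * rise⁻  ≤⟨ +-monoʳ-≤ _ (*-monoʳ-≤ t rise⁻≤rise⁺) ⟩
    ψ⁺ x y + ψ⁻ (x + t) y + t * rise⁺  ≡⟨ expand x t y ⟩
    ψ⁺ (x + t) y + ψ⁻ x y + t * rise⁻  ∎)
  where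
  open ≤-Reasoning
  rise⁻ = 2 * y * (2 * x + t)
  rise⁺ = (x + t) * (x + t) + (x + t) * x + x * x + 2 * y * y
  expand : ∀ x t y →
    x * x * x + 2 * x * y * y + 2 * (x + t) * (x + t) * y
      + t * ((x + t) * (x + t) + (x + t) * x + x * x + 2 * y * y)
    ≡ (x + t) * (x + t) * (x + t) + 2 * (x + t) * y * y + 2 * x * x * y + t * (2 * y * (2 * x + t))
  expand = solve-∀
  double : ∀ x t y → 2 * y * (2 * y) + (2 * x + t) * (2 * x + t) + (x * x + (x + t) * (x + t))
                   ≡ 2 * ((x + t) * (x + t) + (x + t) * x + x * x + 2 * y * y)
  double = solve-∀
  rise⁻≤rise⁺ : rise⁻ ≤ rise⁺
  rise⁻≤rise⁺ = *-cancelˡ-≤ 2 (begin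
    2 * (2 * y * (2 * x + t))                                                  ≤⟨ 2mn≤m²+n² (2 * y) (2 * x + t) ⟩
    2 * y * (2 * y) + (2 * x + t) * (2 * x + t)                                ≤⟨ m≤m+n _ _ ⟩
    2 * y * (2 * y) + (2 * x + t) * (2 * x + t) + (x * x + (x + t) * (x + t))  ≡⟨ double x t y ⟩
    2 * rise⁺                                                                  ∎)

CubicBound : ℕ → ℕ → Set
CubicBound v e = ψ⁺ e v ≤ v * v * v * v + ψ⁻ e v

ψ⁺-scale : ∀ x y c → ψ⁺ (x * c) (y * c) ≡ c * c * c * ψ⁺ x y
ψ⁺-scale = expanded
  where
  expanded : ∀ x y c → x * c * (x * c) * (x * c) + 2 * (x * c) * (y * c) * (y * c)
                     ≡ c * c * c * (x * x * x + 2 * x * y * y)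
  expanded = solve-∀

ψ⁻-scale : ∀ x y c → ψ⁻ (x * c) (y * c) ≡ c * c * c * ψ⁻ x y
ψ⁻-scale = expanded
  where
  expanded : ∀ x y c → 2 * (x * c) * (x * c) * (y * c) ≡ c * c * c * (2 * x * x * y)
  expanded = solve-∀

ψ⁺-monoʳ : ∀ x {y y′} → y ≤ y′ → ψ⁺ x y ≤ ψ⁺ x y′
ψ⁺-monoʳ x y≤y′ = +-monoʳ-≤ (x * x * x) (*-mono-≤ (*-monoʳ-≤ (2 * x) y≤y′) y≤y′)

cube-< : ∀ {m n} → m < n → m * m * m < n * n * n
cube-< m<n = *-mono-< (*-mono-< m<n m<n) m<n

cube-≤ : ∀ {m n} → m ≤ n → m * m * m ≤ n * n * n
cube-≤ m≤n = *-mono-≤ (*-mono-≤ m≤n m≤n) m≤n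

cube-cancel-≤ : ∀ {m n} → m * m * m ≤ n * n * n → m ≤ n
cube-cancel-≤ {m} {n} m³≤n³ with m ≤? n
... | yes m≤n = m≤n
... | no  m≰n = contradiction m³≤n³ (<⇒≱ (cube-< (≰⇒> m≰n)))

cube-cancel-< : ∀ {m n} → m * m * m < n * n * n → m < n
cube-cancel-< {m} {n} m³<n³ with m <? n
... | yes m<n = m<n
... | no  m≮n = contradiction m³<n³ (≤⇒≯ (cube-≤ (≮⇒≥ m≮n)))

-- ψ(e/v) ≤ v < (C/B)³ ≤ ψ(A/B) forces e/v < A/B, as ψ is increasing.
ratio-< : ∀ {v e} A B C → 1 ≤ v → CubicBound v e → v * (B * B * B) < C * C * C →
          C * C * C + ψ⁻ A B ≤ ψ⁺ A B → e * B < A * v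
ratio-< {v} {e} A B C 1≤v bound vB³<C³ C³≤ψ with e * B <? A * v
... | yes eB<Av = eB<Av
... | no eB≮Av = contradiction vB³<C³ (≤⇒≯ C³≤vB³)
  where
  open ≤-Reasoning
  instance
    v³≢0 : NonZero (v * v * v)
    v³≢0 = >-nonZero (*-mono-≤ (*-mono-≤ 1≤v 1≤v) 1≤v)
  v³ = v * v * v
  B³ = B * B * B
  rearrange : ∀ B v p q → B * B * B * (v * v * v * v + p) + v * v * v * q
                        ≡ v * v * v * (v * (B * B * B) + q) + B * B * B * p
  rearrange = solve-∀
  scaled : v³ * (C * C * C + ψ⁻ A B) + B³ * ψ⁻ e v ≤ v³ * (v * B³ + ψ⁻ A B) + B³ * ψ⁻ e v
  scaled = begin
    v³ * (C * C * C + ψ⁻ A B) + B³ * ψ⁻ e v  ≤⟨ +-monoˡ-≤ _ (*-monoʳ-≤ v³ C³≤ψ) ⟩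
    v³ * ψ⁺ A B + B³ * ψ⁻ e v                 ≡⟨ cong₂ _+_ (ψ⁺-scale A B v) (ψ⁻-scale e v B) ⟨
    ψ⁺ (A * v) (B * v) + ψ⁻ (e * B) (v * B)   ≡⟨ cong (λ y → ψ⁺ (A * v) (B * v) + ψ⁻ (e * B) y) (*-comm v B) ⟩
    ψ⁺ (A * v) (B * v) + ψ⁻ (e * B) (B * v)   ≤⟨ ψ-mono (B * v) (≮⇒≥ eB≮Av) ⟩
    ψ⁺ (e * B) (B * v) + ψ⁻ (A * v) (B * v)   ≡⟨ cong (λ y → ψ⁺ (e * B) y + ψ⁻ (A * v) (B * v)) (*-comm B v) ⟩
    ψ⁺ (e * B) (v * B) + ψ⁻ (A * v) (B * v)   ≡⟨ cong₂ _+_ (ψ⁺-scale e v B) (ψ⁻-scale A B v) ⟩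
    B³ * ψ⁺ e v + v³ * ψ⁻ A B                 ≤⟨ +-monoˡ-≤ _ (*-monoʳ-≤ B³ bound) ⟩
    B³ * (v * v * v * v + ψ⁻ e v) + v³ * ψ⁻ A B ≡⟨ rearrange B v (ψ⁻ e v) (ψ⁻ A B) ⟩
    v³ * (v * B³ + ψ⁻ A B) + B³ * ψ⁻ e v      ∎
  C³≤vB³ : C * C * C ≤ v * B³
  C³≤vB³ = +-cancelʳ-≤ (ψ⁻ A B) _ _ (*-cancelˡ-≤ v³ (+-cancelʳ-≤ (B³ * ψ⁻ e v) _ _ scaled))

-- The edge inequality

-- For an edge with end degrees p and q, P = (p − 1) v, Q = (q − 1) v and e = v + w, this is the tangent-plane
-- inequality (p − 1)(q − 1) + (e² w/v³)(1/p + 1/q) ≥ (w/v)(w/v + 2e/v) at p = q = e/v, multiplied by p q v⁴.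
EdgeIneq : ℕ → ℕ → ℕ → ℕ → Set
EdgeIneq v w P Q =
  (v + P) * (v + Q) * w * (w + 2 * (v + w)) ≤ (v + P) * (v + Q) * P * Q + (v + w) * (v + w) * w * (2 * v + P + Q)

edge-swap : ∀ {v w P Q} → EdgeIneq v w P Q → EdgeIneq v w Q P
edge-swap {v} {w} {P} {Q} = subst₂ _≤_ (swapˡ v w P Q) (swapʳ v w P Q)
  where
  swapˡ : ∀ v w P Q → (v + P) * (v + Q) * w * (w + 2 * (v + w)) ≡ (v + Q) * (v + P) * w * (w + 2 * (v + w))
  swapˡ = solve-∀
  swapʳ : ∀ v w P Q → (v + P) * (v + Q) * P * Q + (v + w) * (v + w) * w * (2 * v + P + Q)
                    ≡ (v + Q) * (v + P) * Q * P + (v + w) * (v + w) * w * (2 * v + Q + P)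
  swapʳ = solve-∀

-- In the cases below, given by the position of w among P and Q, the difference of the two sides is a
-- polynomial with nonnegative coefficients in the gaps.
edge-above : ∀ v g a b → EdgeIneq v (v + g) (v + g + a) (v + g + b)
edge-above v g a b = m+o≡n⇒m≤n _ (identity v g a b)
  where
  identity : ∀ v g a b → let w = v + g ; P = w + a ; Q = w + b ; e = v + w in
    (v + P) * (v + Q) * w * (w + 2 * e)
      + (2 * v * v * a * a + 4 * v * v * a * b + 2 * v * v * b * b + 3 * v * g * a * a + 4 * v * g * a * b
         + 3 * v * g * b * b + 3 * v * a * a * b + 3 * v * a * b * b + g * g * a * a + g * g * a * b + g * g * b * b
         + 2 * g * a * a * b + 2 * g * a * b * b + a * a * b * b)
    ≡ (v + P) * (v + Q) * P * Q + e * e * w * (2 * v + P + Q)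
  identity = solve-∀

edge-below : ∀ v g d c → EdgeIneq v (v + g + d + c) (v + g) (v + g + d)
edge-below v g d c = m+o≡n⇒m≤n _ (identity v g d c)
  where
  identity : ∀ v g d c → let P = v + g ; Q = P + d ; w = Q + c ; e = v + w in
    (v + P) * (v + Q) * w * (w + 2 * e)
      + (2 * v * v * d * d + 8 * v * v * d * c + 8 * v * v * c * c + 3 * v * g * d * d + 10 * v * g * d * c
         + 10 * v * g * c * c + 3 * v * d * d * d + 10 * v * d * d * c + 11 * v * d * c * c + 4 * v * c * c * c
         + g * g * d * d + 3 * g * g * d * c + 3 * g * g * c * c + 2 * g * d * d * d + 6 * g * d * d * c
         + 6 * g * d * c * c + 2 * g * c * c * c + d * d * d * d + 3 * d * d * d * c + 3 * d * d * c * c + d * c * c * c)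
    ≡ (v + P) * (v + Q) * P * Q + e * e * w * (2 * v + P + Q)
  identity = solve-∀

edge-between-far : ∀ v g b d → EdgeIneq v (v + g + (b + d)) (v + g) (v + g + (b + d) + b)
edge-between-far v g b d = m+o≡n⇒m≤n _ (identity v g b d)
  where
  identity : ∀ v g b d → let P = v + g ; w = P + (b + d) ; Q = w + b ; e = v + w in
    (v + P) * (v + Q) * w * (w + 2 * e)
      + (2 * v * v * d * d + 2 * v * g * b * b + 2 * v * g * b * d + 3 * v * g * d * d + 2 * v * b * b * b
         + 7 * v * b * b * d + 8 * v * b * d * d + 3 * v * d * d * d + g * g * b * b + g * g * b * d + g * g * d * d
         + 2 * g * b * b * b + 6 * g * b * b * d + 6 * g * b * d * d + 2 * g * d * d * d + 2 * b * b * b * b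
         + 7 * b * b * b * d + 9 * b * b * d * d + 5 * b * d * d * d + d * d * d * d)
    ≡ (v + P) * (v + Q) * P * Q + e * e * w * (2 * v + P + Q)
  identity = solve-∀

-- The remainder now has the negative term v a² d, absorbed by v²d² + a⁴ (AM-GM).
edge-between-near : ∀ v g a d → EdgeIneq v (v + g + a) (v + g) (v + g + a + (a + d))
edge-between-near v g a d = +-cancelʳ-≤ (v * d * (a * a)) _ _ (begin
  L + v * d * (a * a)
    ≤⟨ +-monoʳ-≤ L (≤-trans (m≤m+n (v * d * (a * a)) (v * d * (a * a) + 0)) (2mn≤m²+n² (v * d) (a * a))) ⟩
  L + (v * d * (v * d) + a * a * (a * a))  ≤⟨ +-monoʳ-≤ L (m≤m+n _ R) ⟩
  L + (v * d * (v * d) + a * a * (a * a) + R) ≡⟨ identity v g a d ⟩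
  _ ∎)
  where
  open ≤-Reasoning
  L = let P = v + g ; w = P + a ; Q = w + (a + d) in (v + P) * (v + Q) * w * (w + 2 * (v + w))
  R = v * v * d * d + 2 * v * g * a * a + 2 * v * g * a * d + 3 * v * g * d * d + 2 * v * a * a * a + g * g * a * a
      + g * g * a * d + g * g * d * d + 2 * g * a * a * a + a * a * a * a + a * a * a * d
  identity : ∀ v g a d → let P = v + g ; w = P + a ; Q = w + (a + d) ; e = v + w in
    (v + P) * (v + Q) * w * (w + 2 * e)
      + (v * d * (v * d) + a * a * (a * a)
         + (v * v * d * d + 2 * v * g * a * a + 2 * v * g * a * d + 3 * v * g * d * d + 2 * v * a * a * a
            + g * g * a * a + g * g * a * d + g * g * d * d + 2 * g * a * a * a + a * a * a * a + a * a * a * d))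
    ≡ (v + P) * (v + Q) * P * Q + e * e * w * (2 * v + P + Q) + v * d * (a * a)
  identity = solve-∀

LeafCondition : ℕ → ℕ → Set
LeafCondition v e = 3 * v * v * e ≤ (v + 1) * e * e + v * v * v

affine-≤ : ∀ {a b c d} X r → a ≤ c → a + (X + r) * b ≤ c + (X + r) * d → a + X * b ≤ c + X * d
affine-≤ {a} {b} {c} {d} X r a≤c at-end with b ≤? d
... | yes b≤d = +-mono-≤ a≤c (*-monoʳ-≤ X b≤d)
... | no  b≰d = +-cancelʳ-≤ (r * b) _ _ (begin
  a + X * b + r * b   ≡⟨ split a X r b ⟨
  a + (X + r) * b     ≤⟨ at-end ⟩
  c + (X + r) * d     ≡⟨ split c X r d ⟩
  c + X * d + r * d   ≤⟨ +-monoʳ-≤ (c + X * d) (*-monoʳ-≤ r (<⇒≤ (≰⇒> b≰d))) ⟩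
  c + X * d + r * b   ∎)
  where
  open ≤-Reasoning
  split : ∀ a X r b → a + (X + r) * b ≡ a + X * b + r * b
  split = solve-∀

-- For a leaf (P = 0) both sides are affine in Q, and at the endpoint v + Q = v² the inequality is the
-- leaf condition.
edge-leaf : ∀ {v w Q} → LeafCondition v (v + w) → v + Q ≤ v * v → EdgeIneq v w 0 Q
edge-leaf {v} {w} {Q} leaf v+Q≤v² with m≤n⇒∃[o]m+o≡n v+Q≤v²
... | r , v+Q+r≡v² = subst₂ _≤_ (factorˡ v w Q) (factorʳ v w Q) (*-monoʳ-≤ w (affine-≤ Q r at-0 at-end))
  where
  open ≤-Reasoning
  e = v + w
  M = Q + r
  at-0 : v * v * (w + 2 * e) ≤ 2 * v * (e * e)
  at-0 = m+o≡n⇒m≤n (v * (v * w + 2 * w * w)) (identity v w)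
    where
    identity : ∀ v w → v * v * (w + 2 * (v + w)) + v * (v * w + 2 * w * w) ≡ 2 * v * ((v + w) * (v + w))
    identity = solve-∀
  at-end : v * v * (w + 2 * e) + M * (v * (w + 2 * e)) ≤ 2 * v * (e * e) + M * (e * e)
  at-end = begin
    v * v * (w + 2 * e) + M * (v * (w + 2 * e))  ≡⟨ factor v w M ⟩
    v * ((v + M) * (w + 2 * e))                  ≡⟨ cong (λ y → v * (y * (w + 2 * e))) v+M≡v² ⟩
    v * (v * v * (w + 2 * e))
      ≤⟨ *-monoʳ-≤ v (+-cancelʳ-≤ (v * v * v) _ _ (≤-trans (≤-reflexive (tripled v w)) leaf)) ⟩
    v * ((v + 1) * e * e)                        ≡⟨ regroup v e ⟩
    e * e * (v + v * v)                          ≡⟨ cong (λ y → e * e * (v + y)) v+M≡v² ⟨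
    e * e * (v + (v + M))                        ≡⟨ spread e v M ⟩
    2 * v * (e * e) + M * (e * e)                ∎
    where
    v+M≡v² : v + M ≡ v * v
    v+M≡v² = trans (sym (+-assoc v Q r)) v+Q+r≡v²
    factor : ∀ v w M → v * v * (w + 2 * (v + w)) + M * (v * (w + 2 * (v + w))) ≡ v * ((v + M) * (w + 2 * (v + w)))
    factor = solve-∀
    tripled : ∀ v w → v * v * (w + 2 * (v + w)) + v * v * v ≡ 3 * v * v * (v + w)
    tripled = solve-∀
    regroup : ∀ v e → v * ((v + 1) * e * e) ≡ e * e * (v + v * v)
    regroup = solve-∀
    spread : ∀ e v M → e * e * (v + (v + M)) ≡ 2 * v * (e * e) + M * (e * e)
    spread = solve-∀
  factorˡ : ∀ v w Q → w * (v * v * (w + 2 * (v + w)) + Q * (v * (w + 2 * (v + w))))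
                    ≡ (v + 0) * (v + Q) * w * (w + 2 * (v + w))
  factorˡ = solve-∀
  factorʳ : ∀ v w Q → w * (2 * v * ((v + w) * (v + w)) + Q * ((v + w) * (v + w)))
                    ≡ (v + 0) * (v + Q) * 0 * Q + (v + w) * (v + w) * w * (2 * v + 0 + Q)
  factorʳ = solve-∀

edge-between : ∀ {v w P Q} → v ≤ P → P ≤ w → w ≤ Q → EdgeIneq v w P Q
edge-between {v} v≤P P≤w w≤Q with m≤n⇒∃[o]m+o≡n v≤P | m≤n⇒∃[o]m+o≡n P≤w | m≤n⇒∃[o]m+o≡n w≤Q
... | g , refl | α , refl | β , refl with ≤-total β α
...   | inj₁ β≤α with m≤n⇒∃[o]m+o≡n β≤α
...     | d , refl = edge-between-far v g β d
edge-between {v} v≤P P≤w w≤Q | g , refl | α , refl | β , refl | inj₂ α≤β with m≤n⇒∃[o]m+o≡n α≤β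
...     | d , refl = edge-between-near v g α d

edge-ordered : ∀ {v w P Q} → v ≤ P → P ≤ Q → Q ≤ w → EdgeIneq v w P Q
edge-ordered {v} v≤P P≤Q Q≤w with m≤n⇒∃[o]m+o≡n v≤P | m≤n⇒∃[o]m+o≡n P≤Q | m≤n⇒∃[o]m+o≡n Q≤w
... | g , refl | d , refl | c , refl = edge-below v g d c

edge-large : ∀ {v w P Q} → v ≤ w → v ≤ P → v ≤ Q → EdgeIneq v w P Q
edge-large {v} {w} {P} {Q} v≤w v≤P v≤Q with ≤-total w P | ≤-total w Q
... | inj₁ w≤P | inj₁ w≤Q with m≤n⇒∃[o]m+o≡n v≤w
...   | g , refl with m≤n⇒∃[o]m+o≡n w≤P | m≤n⇒∃[o]m+o≡n w≤Q
...     | a , refl | b , refl = edge-above v g a b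
edge-large {v} {w} {P} {Q} v≤w v≤P v≤Q | inj₁ w≤P | inj₂ Q≤w = edge-swap {v} {w} {Q} {P} (edge-between v≤Q Q≤w w≤P)
edge-large v≤w v≤P v≤Q | inj₂ P≤w | inj₁ w≤Q = edge-between v≤P P≤w w≤Q
edge-large {v} {w} {P} {Q} v≤w v≤P v≤Q | inj₂ P≤w | inj₂ Q≤w with ≤-total P Q
... | inj₁ P≤Q = edge-ordered v≤P P≤Q Q≤w
... | inj₂ Q≤P = edge-swap {v} {w} {Q} {P} (edge-ordered v≤Q Q≤P P≤w)

edge-inequality : ∀ {v w} p′ q′ → v ≤ w → LeafCondition v (v + w) → suc p′ ≤ v → suc q′ ≤ v →
  EdgeIneq v w (p′ * v) (q′ * v)
edge-inequality {v} {w} zero q′ v≤w leaf p≤v q≤v = edge-leaf {v} {w} leaf (*-monoˡ-≤ v q≤v)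
edge-inequality {v} {w} (suc p′) zero v≤w leaf p≤v q≤v = edge-swap {v} {w} {0} (edge-leaf {v} {w} leaf (*-monoˡ-≤ v p≤v))
edge-inequality {v} (suc p′) (suc q′) v≤w leaf p≤v q≤v = edge-large v≤w (m≤m+n v (p′ * v)) (m≤m+n v (q′ * v))

-- share n d = n!/d stands in for 1/d: the d edges at a vertex of degree d ≤ n carry n! in total.
share : ℕ → ℕ → ℕ
share n zero    = 0
share n (suc d) = n ! / suc d

share-spec : ∀ {n} d → 0 < d → d ≤ n → d * share n d ≡ n !
share-spec (suc d) _ d≤n = trans (*-comm (suc d) _) (m/n*n≡m (∣-trans (m∣m*n (d !)) (m≤n⇒m!∣n! d≤n)))

share-≤ : ∀ {n} d → d ≤ n → d * share n d ≤ n !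
share-≤ zero    _   = z≤n
share-≤ (suc d) d≤n = ≤-reflexive (share-spec (suc d) z<s d≤n)

-- Multiplying the edge inequality by λp λq, where p λp = q λq = v! = L, turns (v + P)(v + Q) into (L v)².
edge-weighted : ∀ {v w} p q → 0 < p → p ≤ v → 0 < q → q ≤ v → 1 ≤ v → v ≤ w → LeafCondition v (v + w) →
  v ! * v * (w * (w + 2 * (v + w))) ≤ v ! * v * ((p ∸ 1) * (q ∸ 1) * (v * v)) + (v + w) * (v + w) * w * (share v p + share v q)
edge-weighted {v} {w} p@(suc p′) q@(suc q′) 0<p p≤v 0<q q≤v 1≤v v≤w leaf = *-cancelˡ-≤ (L * v) (begin
  L * v * (L * v * X)                                      ≡⟨ cong₂ (λ l l′ → l * v * (l′ * v * X)) p·λp≡L q·λq≡L ⟨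
  suc p′ * λp * v * (suc q′ * λq * v * X)                  ≡⟨ scaleˡ v w p′ q′ λp λq ⟩
  λp * λq * ((v + p′ * v) * (v + q′ * v) * w * (w + 2 * (v + w))) ≤⟨ *-monoʳ-≤ (λp * λq) edge ⟩
  λp * λq * ((v + p′ * v) * (v + q′ * v) * (p′ * v) * (q′ * v) + E * (2 * v + p′ * v + q′ * v))
                                                           ≡⟨ scaleʳ v w p′ q′ λp λq ⟩
  suc p′ * λp * v * (suc q′ * λq * v * Z) + v * E * (suc q′ * λq * λp + suc p′ * λp * λq)
                                                           ≡⟨ cong₂ (λ l l′ → l * v * (l′ * v * Z) + v * E * (l′ * λp + l * λq)) p·λp≡L q·λq≡L ⟩
  L * v * (L * v * Z) + v * E * (L * λp + L * λq)          ≡⟨ collect L v Z E λp λq ⟩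
  L * v * (L * v * Z + E * (λp + λq))                      ∎)
  where
  open ≤-Reasoning
  instance
    Lv≢0 : NonZero (v ! * v)
    Lv≢0 = m*n≢0 (v !) v {{v !≢0}} {{>-nonZero 1≤v}}
  L = v !
  λp = share v p
  λq = share v q
  p·λp≡L = share-spec p 0<p p≤v
  q·λq≡L = share-spec q 0<q q≤v
  edge = edge-inequality p′ q′ v≤w leaf p≤v q≤v
  X = w * (w + 2 * (v + w))
  Z = p′ * q′ * (v * v)
  E = (v + w) * (v + w) * w
  scaleˡ : ∀ v w p′ q′ λp λq → suc p′ * λp * v * (suc q′ * λq * v * (w * (w + 2 * (v + w))))
                             ≡ λp * λq * ((v + p′ * v) * (v + q′ * v) * w * (w + 2 * (v + w)))
  scaleˡ = solve-∀
  scaleʳ : ∀ v w p′ q′ λp λq →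
    λp * λq * ((v + p′ * v) * (v + q′ * v) * (p′ * v) * (q′ * v) + (v + w) * (v + w) * w * (2 * v + p′ * v + q′ * v))
    ≡ suc p′ * λp * v * (suc q′ * λq * v * (p′ * q′ * (v * v))) + v * ((v + w) * (v + w) * w) * (suc q′ * λq * λp + suc p′ * λp * λq)
  scaleʳ = solve-∀
  collect : ∀ L v Z E λp λq → L * v * (L * v * Z) + v * E * (L * λp + L * λq) ≡ L * v * (L * v * Z + E * (λp + λq))
  collect = solve-∀

-- Sparse graphs

-- Either the edge inequality applies (average degree at least 2 and the leaf condition) or the conclusion
-- holds outright.
Dichotomy : ℕ → ℕ → Set
Dichotomy v e = (v + v ≤ e × LeafCondition v e) ⊎ CubicBound v e

3v≤e⇒dense : ∀ {v e} → 3 * v ≤ e → v + v ≤ e × LeafCondition v e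
3v≤e⇒dense {v} {e} 3v≤e = ≤-trans (+-monoʳ-≤ v (m≤m+n v (v + 0))) 3v≤e , (begin
  3 * v * v * e                      ≤⟨ *-monoˡ-≤ e (*-monoˡ-≤ v 3v≤e) ⟩
  e * v * e                          ≡⟨ cong (_* e) (*-comm e v) ⟩
  v * e * e                          ≤⟨ *-monoˡ-≤ e (*-monoˡ-≤ e (m≤m+n v 1)) ⟩
  (v + 1) * e * e                    ≤⟨ m≤m+n _ (v * v * v) ⟩
  (v + 1) * e * e + v * v * v        ∎)
  where open ≤-Reasoning

-- Below 3v the cubic bound follows from monotonicity of ψ once v ≥ 15; smaller cases are decided by evaluation.
sparse-cubic : ∀ {v e} → 15 ≤ v → e ≤ 3 * v → CubicBound v e
sparse-cubic {v} {e} 15≤v e≤3v = +-cancelʳ-≤ (ψ⁻ (3 * v) v) _ _ (begin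
  ψ⁺ e v + ψ⁻ (3 * v) v                   ≤⟨ ψ-mono v e≤3v ⟩
  ψ⁺ (3 * v) v + ψ⁻ e v                   ≡⟨ cong (_+ ψ⁻ e v) (at-3v v) ⟩
  15 * (v * v * v) + ψ⁻ (3 * v) v + ψ⁻ e v ≤⟨ +-monoˡ-≤ (ψ⁻ e v) (+-monoˡ-≤ (ψ⁻ (3 * v) v) (*-monoˡ-≤ (v * v * v) 15≤v)) ⟩
  v * (v * v * v) + ψ⁻ (3 * v) v + ψ⁻ e v ≡⟨ swap (v * (v * v * v)) (ψ⁻ (3 * v) v) (ψ⁻ e v) ⟩
  v * (v * v * v) + ψ⁻ e v + ψ⁻ (3 * v) v ≡⟨ cong (λ x → x + ψ⁻ e v + ψ⁻ (3 * v) v) (v⁴ v) ⟩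
  v * v * v * v + ψ⁻ e v + ψ⁻ (3 * v) v   ∎)
  where
  open ≤-Reasoning
  at-3v : ∀ v → 3 * v * (3 * v) * (3 * v) + 2 * (3 * v) * v * v ≡ 15 * (v * v * v) + 2 * (3 * v) * (3 * v) * v
  at-3v = solve-∀
  swap : ∀ x y z → x + y + z ≡ x + z + y
  swap = solve-∀
  v⁴ : ∀ v → v * (v * v * v) ≡ v * v * v * v
  v⁴ = solve-∀

dichotomy? : ∀ v e → Dec (Dichotomy v e)
dichotomy? v e = ((v + v ≤? e) ×-dec (3 * v * v * e ≤? (v + 1) * e * e + v * v * v)) ⊎-dec (ψ⁺ e v ≤? v * v * v * v + ψ⁻ e v)

small-dichotomy : ∀ {v e} → v < 15 → e < 42 → Dichotomy v e
small-dichotomy v<15 e<42 =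
  subst₂ Dichotomy (Fin.toℕ-fromℕ< v<15) (Fin.toℕ-fromℕ< e<42) (table (Fin.fromℕ< v<15) (Fin.fromℕ< e<42))
  where
  table : ∀ (i : Fin 15) (j : Fin 42) → Dichotomy (Fin.toℕ i) (Fin.toℕ j)
  table = from-yes (Fin.all? {n = 15} λ i → Fin.all? {n = 42} λ j → dichotomy? (Fin.toℕ i) (Fin.toℕ j))

dichotomy : ∀ v e → Dichotomy v e
dichotomy v e with 3 * v ≤? e
... | yes 3v≤e = inj₁ (3v≤e⇒dense {v} {e} 3v≤e)
... | no  3v≰e with 15 ≤? v
...   | yes 15≤v = inj₂ (sparse-cubic 15≤v (<⇒≤ (≰⇒> 3v≰e)))
...   | no  15≰v = small-dichotomy (≰⇒> 15≰v) (≤-trans (≰⇒> 3v≰e) (*-monoʳ-≤ 3 (≤-pred (≰⇒> 15≰v))))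

-- Finite sums over Fin

∑-mono-≤ : ∀ {n} {f g : Fin n → ℕ} → (∀ i → f i ≤ g i) → ∑[ i < n ] f i ≤ ∑[ i < n ] g i
∑-mono-≤ {zero}  f≤g = z≤n
∑-mono-≤ {suc n} f≤g = +-mono-≤ (f≤g zero) (∑-mono-≤ (f≤g ∘ suc))

∑-const : ∀ n c → ∑[ i < n ] c ≡ n * c
∑-const zero    c = refl
∑-const (suc n) c = cong (c +_) (∑-const n c)

∑-*ˡ : ∀ {n} c (f : Fin n → ℕ) → ∑[ i < n ] (c * f i) ≡ c * ∑[ i < n ] f i
∑-*ˡ c f = sym (*-distribˡ-sum c f)

∑-linear₃ : ∀ {n} x y z (f g h : Fin n → ℕ) →
  ∑[ i < n ] (x * f i + y * g i + z * h i) ≡ x * ∑[ i < n ] f i + y * ∑[ i < n ] g i + z * ∑[ i < n ] h i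
∑-linear₃ x y z f g h = trans (∑-distrib-+ _ (λ i → z * h i))
  (cong₂ _+_ (trans (∑-distrib-+ (λ i → x * f i) _) (cong₂ _+_ (∑-*ˡ x f) (∑-*ˡ y g))) (∑-*ˡ z h))

∑-tabulate : ∀ n (f : Fin n → ℕ) → List.sum (List.map f (List.allFin n)) ≡ ∑[ i < n ] f i
∑-tabulate n f = trans (cong List.sum (List.map-tabulate (λ i → i) f)) (go n f)
  where
  go : ∀ n (f : Fin n → ℕ) → List.sum (List.tabulate f) ≡ ∑[ i < n ] f i
  go zero    f = refl
  go (suc n) f = cong (f zero +_) (go n (f ∘ suc))

∑-witness : ∀ {n} (f : Fin n → ℕ) → 0 < ∑[ i < n ] f i → ∃[ i ] 0 < f i
∑-witness {suc n} f 0<∑ with f zero in eq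
... | suc _ = zero , subst (0 <_) (sym eq) z<s
... | zero with ∑-witness (f ∘ suc) 0<∑
...   | i , 0<fi = suc i , 0<fi

∑-≡0 : ∀ {n} (f : Fin n → ℕ) → (∀ i → 0 < f i → ⊥) → ∑[ i < n ] f i ≡ 0
∑-≡0 f none with ∑[ i < _ ] f i in eq
... | zero  = refl
... | suc _ with ∑-witness f (subst (0 <_) (sym eq) z<s)
...   | i , 0<fi = contradiction 0<fi (none i)

∑-≤1 : ∀ {n} {f : Fin n → ℕ} → (∀ i → f i ≤ 1) → (∀ i j → 0 < f i → 0 < f j → i ≡ j) → ∑[ i < n ] f i ≤ 1
∑-≤1 {zero}  f≤1 unique = z≤n
∑-≤1 {suc n} {f} f≤1 unique with f zero in eq
... | zero  = ∑-≤1 (f≤1 ∘ suc) (λ i j 0<fi 0<fj → Fin.suc-injective (unique (suc i) (suc j) 0<fi 0<fj))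
... | suc m = subst (λ s → suc m + s ≤ 1) (sym rest≡0) (subst (_≤ 1) (trans eq (sym (+-identityʳ _))) (f≤1 zero))
  where
  rest≡0 : ∑[ i < n ] f (suc i) ≡ 0
  rest≡0 = ∑-≡0 (f ∘ suc) λ i 0<fi → contradiction (unique zero (suc i) (subst (0 <_) (sym eq) z<s) 0<fi) λ ()

apart : ∀ {n} → Fin n → Fin n → ℕ
apart i j = if does (i Fin.≟ j) then 0 else 1

apart-≤1 : ∀ {n} (i j : Fin n) → apart i j ≤ 1
apart-≤1 i j with i Fin.≟ j
... | yes _ = z≤n
... | no  _ = s≤s z≤n

apart⇒≢ : ∀ {n} {i j : Fin n} → 0 < apart i j → i ≢ j
apart⇒≢ {i = i} {j} 0<apart with i Fin.≟ j
... | no i≢j = i≢j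

∑-punctured : ∀ {n} (f : Fin n → ℕ) k → ∑[ i < n ] f i ≡ f k + ∑[ i < n ] (f i * apart i k)
∑-punctured {suc n} f zero = cong (f zero +_) (begin
  ∑[ i < n ] f (suc i)                          ≡⟨ sum-cong-≗ (λ i → *-identityʳ (f (suc i))) ⟨
  ∑[ i < n ] (f (suc i) * 1)                    ≡⟨ cong (_+ ∑[ i < n ] (f (suc i) * 1)) (*-zeroʳ (f zero)) ⟨
  f zero * 0 + ∑[ i < n ] (f (suc i) * 1)       ∎)
  where open ≡-Reasoning
∑-punctured {suc n} f (suc k) = trans (cong (f zero +_) (∑-punctured (f ∘ suc) k)) (swap (f zero) (f (suc k)) _)
  where
  swap : ∀ a b t → a + (b + t) ≡ b + (a * 1 + t)
  swap = solve-∀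

0<*⇒ : ∀ {m n} → 0 < m * n → 0 < m × 0 < n
0<*⇒ {suc m} {suc n} _ = z<s , z<s
0<*⇒ {suc m} {zero}  0<mn = contradiction (subst (0 <_) (*-zeroʳ m) 0<mn) λ ()

-- Paths of length 3 in a bipartite graph of girth at least 8

module Counting {v : ℕ} (R : Fin v → Fin v → Bool) where

  adj : Fin v → Fin v → ℕ
  adj a b = if R a b then 1 else 0

  deg₁ deg₂ : Fin v → ℕ
  deg₁ a = ∑[ b < v ] adj a b
  deg₂ b = ∑[ a < v ] adj a b

  edges : ℕ
  edges = ∑[ a < v ] deg₁ a

  edgeCount≡edges : edgeCount v R ≡ edges
  edgeCount≡edges = trans (∑-tabulate v _) (sum-cong-≗ (λ a → ∑-tabulate v (adj a)))

  adj-≤1 : ∀ a b → adj a b ≤ 1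
  adj-≤1 a b with R a b
  ... | true  = s≤s z≤n
  ... | false = z≤n

  adj⇒R : ∀ {a b} → 0 < adj a b → R a b ≡ true
  adj⇒R {a} {b} 0<adj with R a b
  ... | true = refl

  path₃ : Fin v → Fin v → Fin v → Fin v → ℕ
  path₃ a b a′ b′ = adj a′ b * (adj a b * apart a a′ * (adj a′ b′ * apart b′ b))

  record IsPath (a b a′ b′ : Fin v) : Set where
    field
      ab   : R a b ≡ true
      a′b  : R a′ b ≡ true
      a′b′ : R a′ b′ ≡ true
      a≢a′ : a ≢ a′
      b≢b′ : b ≢ b′

  path₃⇒IsPath : ∀ {a b a′ b′} → 0 < path₃ a b a′ b′ → IsPath a b a′ b′
  path₃⇒IsPath 0<path₃ with 0<*⇒ 0<path₃
  ... | 0<a′b , 0<rest with 0<*⇒ 0<rest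
  ...   | 0<left , 0<right with 0<*⇒ 0<left | 0<*⇒ 0<right
  ...     | 0<ab , 0<apart | 0<a′b′ , 0<apart′ = record
    { ab = adj⇒R 0<ab ; a′b = adj⇒R 0<a′b ; a′b′ = adj⇒R 0<a′b′
    ; a≢a′ = apart⇒≢ 0<apart ; b≢b′ = apart⇒≢ 0<apart′ ∘ sym }

  path₃-≤1 : ∀ a b a′ b′ → path₃ a b a′ b′ ≤ 1
  path₃-≤1 a b a′ b′ =
    *-mono-≤ (adj-≤1 a′ b) (*-mono-≤ (*-mono-≤ (adj-≤1 a b) (apart-≤1 a a′)) (*-mono-≤ (adj-≤1 a′ b′) (apart-≤1 b′ b)))

  total-paths₃ : ℕ
  total-paths₃ = ∑[ a′ < v ] ∑[ b < v ] (adj a′ b * ((deg₂ b ∸ 1) * (deg₁ a′ ∸ 1)))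

  adj-true : ∀ {a b} → R a b ≡ true → adj a b ≡ 1
  adj-true {a} {b} ab = cong (λ x → if x then 1 else 0) ab

  paths₃-through : ∀ a′ b → ∑[ a < v ] ∑[ b′ < v ] path₃ a b a′ b′ ≡ adj a′ b * ((deg₂ b ∸ 1) * (deg₁ a′ ∸ 1))
  paths₃-through a′ b = begin
    ∑[ a < v ] ∑[ b′ < v ] (c * (X a * Y b′))    ≡⟨ sum-cong-≗ (λ a → sum-cong-≗ (λ b′ → *-assoc c (X a) (Y b′))) ⟨
    ∑[ a < v ] ∑[ b′ < v ] (c * X a * Y b′)      ≡⟨ sum-cong-≗ (λ a → *-distribˡ-sum (c * X a) Y) ⟨
    ∑[ a < v ] (c * X a * ∑[ b′ < v ] Y b′)      ≡⟨ *-distribʳ-sum (∑[ b′ < v ] Y b′) (λ a → c * X a) ⟨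
    ∑[ a < v ] (c * X a) * ∑[ b′ < v ] Y b′      ≡⟨ cong (_* ∑[ b′ < v ] Y b′) (*-distribˡ-sum c X) ⟨
    c * ∑[ a < v ] X a * ∑[ b′ < v ] Y b′        ≡⟨ *-assoc c _ _ ⟩
    c * (∑[ a < v ] X a * ∑[ b′ < v ] Y b′)      ≡⟨ punctured-degrees ⟩
    c * ((deg₂ b ∸ 1) * (deg₁ a′ ∸ 1))           ∎
    where
    open ≡-Reasoning
    c = adj a′ b
    X = λ a → adj a b * apart a a′
    Y = λ b′ → adj a′ b′ * apart b′ b
    punctured-degrees : c * (∑[ a < v ] X a * ∑[ b′ < v ] Y b′) ≡ c * ((deg₂ b ∸ 1) * (deg₁ a′ ∸ 1))
    punctured-degrees with R a′ b in a′b
    ... | false = refl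
    ... | true  = cong (λ z → 1 * z) (cong₂ _*_
      (sym (cong (_∸ 1) (trans (∑-punctured (λ a → adj a b) a′) (cong (_+ ∑[ a < v ] X a) (adj-true a′b)))))
      (sym (cong (_∸ 1) (trans (∑-punctured (adj a′) b) (cong (_+ ∑[ b′ < v ] Y b′) (adj-true a′b))))))

  ∑-paths₃ : ∑[ a < v ] ∑[ b′ < v ] ∑[ b < v ] ∑[ a′ < v ] path₃ a b a′ b′ ≡ total-paths₃
  ∑-paths₃ = begin
    ∑[ a < v ] ∑[ b′ < v ] ∑[ b < v ] ∑[ a′ < v ] path₃ a b a′ b′
      ≡⟨ sum-cong-≗ (λ a → ∑-comm (λ b′ b → ∑[ a′ < v ] path₃ a b a′ b′)) ⟩
    ∑[ a < v ] ∑[ b < v ] ∑[ b′ < v ] ∑[ a′ < v ] path₃ a b a′ b′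
      ≡⟨ sum-cong-≗ (λ a → sum-cong-≗ (λ b → ∑-comm (λ b′ a′ → path₃ a b a′ b′))) ⟩
    ∑[ a < v ] ∑[ b < v ] ∑[ a′ < v ] ∑[ b′ < v ] path₃ a b a′ b′
      ≡⟨ sum-cong-≗ (λ a → ∑-comm (λ b a′ → ∑[ b′ < v ] path₃ a b a′ b′)) ⟩
    ∑[ a < v ] ∑[ a′ < v ] ∑[ b < v ] ∑[ b′ < v ] path₃ a b a′ b′
      ≡⟨ ∑-comm (λ a a′ → ∑[ b < v ] ∑[ b′ < v ] path₃ a b a′ b′) ⟩
    ∑[ a′ < v ] ∑[ a < v ] ∑[ b < v ] ∑[ b′ < v ] path₃ a b a′ b′
      ≡⟨ sum-cong-≗ (λ a′ → ∑-comm (λ a b → ∑[ b′ < v ] path₃ a b a′ b′)) ⟩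
    ∑[ a′ < v ] ∑[ b < v ] ∑[ a < v ] ∑[ b′ < v ] path₃ a b a′ b′
      ≡⟨ sum-cong-≗ (λ a′ → sum-cong-≗ (λ b → paths₃-through a′ b)) ⟩
    total-paths₃
      ∎
    where open ≡-Reasoning

  deg₁-≤ : ∀ a → deg₁ a ≤ v
  deg₁-≤ a = ≤-trans (∑-mono-≤ (adj-≤1 a)) (≤-reflexive (trans (∑-const v 1) (*-identityʳ v)))

  deg₂-≤ : ∀ b → deg₂ b ≤ v
  deg₂-≤ b = ≤-trans (∑-mono-≤ (λ a → adj-≤1 a b)) (≤-reflexive (trans (∑-const v 1) (*-identityʳ v)))

  deg₁-pos : ∀ {a b} → R a b ≡ true → 0 < deg₁ a
  deg₁-pos {a} {b} ab = subst (_≤ deg₁ a) (adj-true ab) (m+o≡n⇒m≤n _ (sym (∑-punctured (adj a) b)))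

  deg₂-pos : ∀ {a b} → R a b ≡ true → 0 < deg₂ b
  deg₂-pos {a} {b} ab = subst (_≤ deg₂ b) (adj-true ab) (m+o≡n⇒m≤n _ (sym (∑-punctured (λ a → adj a b) a)))

  shares₁-≤ : ∑[ a < v ] ∑[ b < v ] (adj a b * share v (deg₁ a)) ≤ v * v !
  shares₁-≤ = begin
    ∑[ a < v ] ∑[ b < v ] (adj a b * share v (deg₁ a))
      ≡⟨ sum-cong-≗ (λ a → *-distribʳ-sum (share v (deg₁ a)) (adj a)) ⟨
    ∑[ a < v ] (deg₁ a * share v (deg₁ a))
      ≤⟨ ∑-mono-≤ (λ a → share-≤ (deg₁ a) (deg₁-≤ a)) ⟩
    ∑[ a < v ] (v !)
      ≡⟨ ∑-const v (v !) ⟩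
    v * v !
      ∎
    where open ≤-Reasoning

  shares₂-≤ : ∑[ a < v ] ∑[ b < v ] (adj a b * share v (deg₂ b)) ≤ v * v !
  shares₂-≤ = begin
    ∑[ a < v ] ∑[ b < v ] (adj a b * share v (deg₂ b))
      ≡⟨ ∑-comm (λ a b → adj a b * share v (deg₂ b)) ⟩
    ∑[ b < v ] ∑[ a < v ] (adj a b * share v (deg₂ b))
      ≡⟨ sum-cong-≗ (λ b → *-distribʳ-sum (share v (deg₂ b)) (λ a → adj a b)) ⟨
    ∑[ b < v ] (deg₂ b * share v (deg₂ b))
      ≤⟨ ∑-mono-≤ (λ b → share-≤ (deg₂ b) (deg₂-≤ b)) ⟩
    ∑[ b < v ] (v !)
      ≡⟨ ∑-const v (v !) ⟩
    v * v !
      ∎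
    where open ≤-Reasoning

  ∑-edge-weights : ∀ K E →
    ∑[ a < v ] ∑[ b < v ] (adj a b * (K * ((deg₂ b ∸ 1) * (deg₁ a ∸ 1) * (v * v)) + E * (share v (deg₂ b) + share v (deg₁ a))))
    ≤ K * (v * v) * total-paths₃ + E * (v * v !) + E * (v * v !)
  ∑-edge-weights K E = begin
    ∑[ a < v ] ∑[ b < v ] (adj a b * (K * (Paths′ a b * (v * v)) + E * (share v (deg₂ b) + share v (deg₁ a))))
      ≡⟨ sum-cong-≗ (λ a → sum-cong-≗ (λ b → distribute (adj a b) K (Paths′ a b) v E _ _)) ⟩
    ∑[ a < v ] ∑[ b < v ] (K * (v * v) * Paths a b + E * S₂ a b + E * S₁ a b)
      ≡⟨ sum-cong-≗ (λ a → ∑-linear₃ (K * (v * v)) E E (Paths a) (S₂ a) (S₁ a)) ⟩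
    ∑[ a < v ] (K * (v * v) * ∑[ b < v ] Paths a b + E * ∑[ b < v ] S₂ a b + E * ∑[ b < v ] S₁ a b)
      ≡⟨ ∑-linear₃ (K * (v * v)) E E (λ a → ∑[ b < v ] Paths a b) (λ a → ∑[ b < v ] S₂ a b) (λ a → ∑[ b < v ] S₁ a b) ⟩
    K * (v * v) * total-paths₃ + E * ∑[ a < v ] ∑[ b < v ] S₂ a b + E * ∑[ a < v ] ∑[ b < v ] S₁ a b
      ≤⟨ +-mono-≤ (+-monoʳ-≤ (K * (v * v) * total-paths₃) (*-monoʳ-≤ E shares₂-≤)) (*-monoʳ-≤ E shares₁-≤) ⟩
    K * (v * v) * total-paths₃ + E * (v * v !) + E * (v * v !)
      ∎
    where
    open ≤-Reasoning
    Paths′ = λ a b → (deg₂ b ∸ 1) * (deg₁ a ∸ 1)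
    Paths = λ a b → adj a b * Paths′ a b
    S₁ = λ a b → adj a b * share v (deg₁ a)
    S₂ = λ a b → adj a b * share v (deg₂ b)
    distribute : ∀ x K P v E s t → x * (K * (P * (v * v)) + E * (s + t)) ≡ K * (v * v) * (x * P) + E * (x * s) + E * (x * t)
    distribute = solve-∀

  paths₃-lower-bound : ∀ {w} → 1 ≤ v → v ≤ w → LeafCondition v (v + w) → edges ≡ v + w →
                       (v + w) * (w * w) ≤ v * v * total-paths₃
  paths₃-lower-bound {w} 1≤v v≤w leaf edges≡e = *-cancelˡ-≤ K (+-cancelʳ-≤ (K * (2 * E)) _ _ (begin
    K * (e * (w * w)) + K * (2 * E)
      ≡⟨ spread K e w ⟨
    e * (K * (w * (w + 2 * e)))
      ≡⟨ cong (_* (K * (w * (w + 2 * e)))) edges≡e ⟨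
    edges * (K * (w * (w + 2 * e)))
      ≡⟨ ∑-edges (K * (w * (w + 2 * e))) ⟨
    ∑[ a < v ] ∑[ b < v ] (adj a b * (K * (w * (w + 2 * e))))
      ≤⟨ ∑-mono-≤ (λ a → ∑-mono-≤ (λ b → per-edge a b)) ⟩
    ∑[ a < v ] ∑[ b < v ] (adj a b * (K * ((deg₂ b ∸ 1) * (deg₁ a ∸ 1) * (v * v)) + E * (share v (deg₂ b) + share v (deg₁ a))))
      ≤⟨ ∑-edge-weights K E ⟩
    K * (v * v) * total-paths₃ + E * (v * v !) + E * (v * v !)
      ≡⟨ collect (v !) v total-paths₃ E ⟩
    K * (v * v * total-paths₃) + K * (2 * E)
      ∎))
    where
    open ≤-Reasoning
    instance
      K≢0 : NonZero (v ! * v)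
      K≢0 = m*n≢0 (v !) v {{v !≢0}} {{>-nonZero 1≤v}}
    e = v + w
    K = v ! * v
    E = e * e * w
    per-edge : ∀ a b → adj a b * (K * (w * (w + 2 * e)))
                     ≤ adj a b * (K * ((deg₂ b ∸ 1) * (deg₁ a ∸ 1) * (v * v)) + E * (share v (deg₂ b) + share v (deg₁ a)))
    per-edge a b with R a b in ab
    ... | false = z≤n
    ... | true  = *-monoʳ-≤ 1 (edge-weighted (deg₂ b) (deg₁ a) (deg₂-pos ab) (deg₂-≤ b) (deg₁-pos ab) (deg₁-≤ a) 1≤v v≤w leaf)
    ∑-edges : ∀ c → ∑[ a < v ] ∑[ b < v ] (adj a b * c) ≡ edges * c
    ∑-edges c = trans (sum-cong-≗ (λ a → sym (*-distribʳ-sum c (adj a)))) (sym (*-distribʳ-sum c deg₁))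
    spread : ∀ K e w → e * (K * (w * (w + 2 * e))) ≡ K * (e * (w * w)) + K * (2 * (e * e * w))
    spread = solve-∀
    collect : ∀ L v T E → L * v * (v * v) * T + E * (v * L) + E * (v * L) ≡ L * v * (v * v * T) + L * v * (2 * E)
    collect = solve-∀

  module _ (girth : GirthAtLeast (bipGraph R) 8) where

    no-4-cycle : ∀ {a a′ b b′} → a ≢ a′ → b ≢ b′ →
      R a b ≡ true → R a′ b ≡ true → R a′ b′ ≡ true → R a b′ ≡ true → ⊥
    no-4-cycle {a} {a′} {b} {b′} a≢a′ b≢b′ ab a′b a′b′ ab′ =
      girth 3 (≤ᵇ⇒≤ 3 4 _) (≤ᵇ⇒≤ 5 8 _) (record
        { vtx      = lookup cycle
        ; distinct = λ {i} {j} → lookup-injective distinct i j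
        ; step     = λ { zero → ab ; (suc zero) → a′b ; (suc (suc zero)) → a′b′ }
        ; close    = ab′ })
      where
      cycle = inj₁ a ∷ inj₂ b ∷ inj₁ a′ ∷ inj₂ b′ ∷ []
      distinct = ((λ ()) ∷ a≢a′ ∘ Sum.inj₁-injective ∷ (λ ()) ∷ [])
               ∷ ((λ ()) ∷ b≢b′ ∘ Sum.inj₂-injective ∷ [])
               ∷ ((λ ()) ∷ [])
               ∷ [] ∷ []

    no-6-cycle : ∀ {a a′ a″ b b′ b″} → a ≢ a′ → a ≢ a″ → a′ ≢ a″ → b ≢ b′ → b ≢ b″ → b′ ≢ b″ →
      R a b ≡ true → R a′ b ≡ true → R a′ b′ ≡ true → R a″ b′ ≡ true → R a″ b″ ≡ true → R a b″ ≡ true → ⊥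
    no-6-cycle {a} {a′} {a″} {b} {b′} {b″} a≢a′ a≢a″ a′≢a″ b≢b′ b≢b″ b′≢b″ ab a′b a′b′ a″b′ a″b″ ab″ =
      girth 5 (≤ᵇ⇒≤ 3 6 _) (≤ᵇ⇒≤ 7 8 _) (record
        { vtx      = lookup cycle
        ; distinct = λ {i} {j} → lookup-injective distinct i j
        ; step     = λ { zero → ab ; (suc zero) → a′b ; (suc (suc zero)) → a′b′
                      ; (suc (suc (suc zero))) → a″b′ ; (suc (suc (suc (suc zero)))) → a″b″ }
        ; close    = ab″ })
      where
      cycle = inj₁ a ∷ inj₂ b ∷ inj₁ a′ ∷ inj₂ b′ ∷ inj₁ a″ ∷ inj₂ b″ ∷ []
      distinct = ((λ ()) ∷ a≢a′ ∘ Sum.inj₁-injective ∷ (λ ()) ∷ a≢a″ ∘ Sum.inj₁-injective ∷ (λ ()) ∷ [])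
               ∷ ((λ ()) ∷ b≢b′ ∘ Sum.inj₂-injective ∷ (λ ()) ∷ b≢b″ ∘ Sum.inj₂-injective ∷ [])
               ∷ ((λ ()) ∷ a′≢a″ ∘ Sum.inj₁-injective ∷ (λ ()) ∷ [])
               ∷ ((λ ()) ∷ b′≢b″ ∘ Sum.inj₂-injective ∷ [])
               ∷ ((λ ()) ∷ [])
               ∷ [] ∷ []

    paths₃-via-≤1 : ∀ a b b′ → ∑[ a′ < v ] path₃ a b a′ b′ ≤ 1
    paths₃-via-≤1 a b b′ = ∑-≤1 (λ a′ → path₃-≤1 a b a′ b′) unique
      where
      unique : ∀ a₁ a₂ → 0 < path₃ a b a₁ b′ → 0 < path₃ a b a₂ b′ → a₁ ≡ a₂
      unique a₁ a₂ p₁ p₂ with a₁ Fin.≟ a₂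
      ... | yes a₁≡a₂ = a₁≡a₂
      ... | no  a₁≢a₂ = contradiction (a′b′ P₁) (λ a₁b′ → no-4-cycle a₁≢a₂ (b≢b′ P₁) (a′b P₁) (a′b P₂) (a′b′ P₂) a₁b′)
        where
        open IsPath
        P₁ = path₃⇒IsPath p₁
        P₂ = path₃⇒IsPath p₂

    paths₃ : Fin v → Fin v → ℕ
    paths₃ a b′ = ∑[ b < v ] ∑[ a′ < v ] path₃ a b a′ b′

    paths₃-≤1 : ∀ a b′ → paths₃ a b′ ≤ 1
    paths₃-≤1 a b′ = ∑-≤1 (λ b → paths₃-via-≤1 a b b′) unique
      where
      open IsPath
      unique : ∀ b₁ b₂ → 0 < ∑[ a′ < v ] path₃ a b₁ a′ b′ → 0 < ∑[ a′ < v ] path₃ a b₂ a′ b′ → b₁ ≡ b₂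
      unique b₁ b₂ p₁ p₂ with b₁ Fin.≟ b₂
      ... | yes b₁≡b₂ = b₁≡b₂
      ... | no  b₁≢b₂ with ∑-witness _ p₁ | ∑-witness _ p₂
      ...   | a₁ , q₁ | a₂ , q₂ with path₃⇒IsPath q₁ | path₃⇒IsPath q₂ | a₁ Fin.≟ a₂
      ...     | P₁ | P₂ | yes refl = contradiction (ab P₂) (no-4-cycle (a≢a′ P₁) b₁≢b₂ (ab P₁) (a′b P₁) (a′b P₂))
      ...     | P₁ | P₂ | no a₁≢a₂ = contradiction (ab P₂)
                  (no-6-cycle (a≢a′ P₁) (a≢a′ P₂) a₁≢a₂ (b≢b′ P₁) b₁≢b₂ (b≢b′ P₂ ∘ sym)
                              (ab P₁) (a′b P₁) (a′b′ P₁) (a′b′ P₂) (a′b P₂))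

    adj+paths₃-≤1 : ∀ a b′ → adj a b′ + paths₃ a b′ ≤ 1
    adj+paths₃-≤1 a b′ with R a b′ in ab′
    ... | false = paths₃-≤1 a b′
    ... | true  = ≤-reflexive (cong suc (∑-≡0 (λ b → ∑[ a′ < v ] path₃ a b a′ b′) no-path))
      where
      no-path : ∀ b → 0 < ∑[ a′ < v ] path₃ a b a′ b′ → ⊥
      no-path b p with ∑-witness (λ a′ → path₃ a b a′ b′) p
      ... | a′ , q = no-4-cycle (a≢a′ P) (b≢b′ P) (ab P) (a′b P) (a′b′ P) ab′
        where
        open IsPath
        P = path₃⇒IsPath q

    edges+paths₃≤v² : edges + total-paths₃ ≤ v * v
    edges+paths₃≤v² = begin
      edges + total-paths₃
        ≡⟨ cong (edges +_) ∑-paths₃ ⟨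
      edges + ∑[ a < v ] ∑[ b′ < v ] paths₃ a b′
        ≡⟨ ∑-distrib-+ deg₁ (λ a → ∑[ b′ < v ] paths₃ a b′) ⟨
      ∑[ a < v ] (deg₁ a + ∑[ b′ < v ] paths₃ a b′)
        ≡⟨ sum-cong-≗ (λ a → ∑-distrib-+ (adj a) (paths₃ a)) ⟨
      ∑[ a < v ] ∑[ b′ < v ] (adj a b′ + paths₃ a b′)
        ≤⟨ ∑-mono-≤ (λ a → ∑-mono-≤ (adj+paths₃-≤1 a)) ⟩
      ∑[ a < v ] ∑[ b′ < v ] 1
        ≡⟨ sum-cong-≗ {n = v} (λ _ → trans (∑-const v 1) (*-identityʳ v)) ⟩
      ∑[ a < v ] v
        ≡⟨ ∑-const v v ⟩
      v * v
        ∎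
      where open ≤-Reasoning

    cubic-bound-dense : ∀ {w} → 1 ≤ v → v ≤ w → LeafCondition v (v + w) → edges ≡ v + w → CubicBound v edges
    cubic-bound-dense {w} 1≤v v≤w leaf edges≡e rewrite edges≡e = begin
      ψ⁺ e v
        ≡⟨ expand v w ⟩
      e * (v * v) + e * (w * w) + ψ⁻ e v
        ≤⟨ +-monoˡ-≤ (ψ⁻ e v) (+-monoʳ-≤ (e * (v * v)) (paths₃-lower-bound 1≤v v≤w leaf edges≡e)) ⟩
      e * (v * v) + v * v * total-paths₃ + ψ⁻ e v
        ≡⟨ cong (_+ ψ⁻ e v) (factor e (v * v) total-paths₃) ⟩
      v * v * (e + total-paths₃) + ψ⁻ e v
        ≤⟨ +-monoˡ-≤ (ψ⁻ e v) (*-monoʳ-≤ (v * v) (subst (λ x → x + total-paths₃ ≤ v * v) edges≡e edges+paths₃≤v²)) ⟩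
      v * v * (v * v) + ψ⁻ e v
        ≡⟨ cong (_+ ψ⁻ e v) (*-assoc (v * v) v v) ⟨
      v * v * v * v + ψ⁻ e v
        ∎
      where
      open ≤-Reasoning
      e = v + w
      expand : ∀ v w → (v + w) * (v + w) * (v + w) + 2 * (v + w) * v * v
                     ≡ (v + w) * (v * v) + (v + w) * (w * w) + 2 * (v + w) * (v + w) * v
      expand = solve-∀
      factor : ∀ e s t → e * s + s * t ≡ s * (e + t)
      factor = solve-∀

    cubic-bound : 1 ≤ v → CubicBound v edges
    cubic-bound 1≤v with dichotomy v edges
    ... | inj₂ cubic = cubic
    ... | inj₁ (2v≤e , leaf) with m≤n⇒∃[o]m+o≡n 2v≤e
    ...   | t , 2v+t≡e = cubic-bound-dense {v + t} 1≤v (m≤m+n v t) (subst (LeafCondition v) e≡v+w leaf) e≡v+w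
      where
      e≡v+w : edges ≡ v + (v + t)
      e≡v+w = trans (sym 2v+t≡e) (+-assoc v v t)

girth-eight-cubic : ∀ {v} (R : Fin v → Fin v → Bool) → 1 ≤ v → GirthAtLeast (bipGraph R) 8 → CubicBound v (edgeCount v R)
girth-eight-cubic {v} R 1≤v girth = subst (CubicBound v) (sym (edgeCount≡edges R)) (cubic-bound R girth 1≤v)
  where open Counting

-- Rational approximation of the cube root

-- For q = k/N, lead k N = 81k²N (q + 2/3) and lag k N = 81k²N (2/(9q) + 20/(81q²)), so that
-- 81 N⁴ · bound q = k (lead k N − lag k N).
lead lag : ℕ → ℕ → ℕ
lead k N = 81 * k * k * k + 54 * k * k * N
lag k N = 18 * k * N * N + 20 * N * N * N

ψ-taylor : ∀ a w b → let y = a + w in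
  ψ⁺ a b + (ψ⁻ y b + w * (3 * y * y + 2 * b * b) + 2 * w * w * b) + w * w * w
  ≡ ψ⁻ a b + (ψ⁺ y b + 4 * w * y * b + 3 * w * w * y)
ψ-taylor = expanded
  where
  expanded : ∀ a w b →
    a * a * a + 2 * a * b * b
      + (2 * (a + w) * (a + w) * b + w * (3 * (a + w) * (a + w) + 2 * b * b) + 2 * w * w * b) + w * w * w
    ≡ 2 * a * a * b
      + ((a + w) * (a + w) * (a + w) + 2 * (a + w) * b * b + 4 * w * (a + w) * b + 3 * w * w * (a + w))
  expanded = solve-∀

ψ-at-lead : ∀ k N → let y = lead k N ; w = lag k N ; b = 81 * k * k * N ; c = 81 * k * k * k in
  ψ⁺ y b + 4 * w * y * b + 3 * w * w * y
  ≡ (ψ⁻ y b + w * (3 * y * y + 2 * b * b) + 2 * w * w * b) + (c * c * c + 4860 * (k * k * k * (N * N * N)) * w)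
ψ-at-lead = expanded
  where
  expanded : ∀ k N → let y = 81 * k * k * k + 54 * k * k * N ; w = 18 * k * N * N + 20 * N * N * N
                         b = 81 * k * k * N ; c = 81 * k * k * k in
    y * y * y + 2 * y * b * b + 4 * w * y * b + 3 * w * w * y
    ≡ (2 * y * y * b + w * (3 * y * y + 2 * b * b) + 2 * w * w * b) + (c * c * c + 4860 * (k * k * k * (N * N * N)) * w)
  expanded = solve-∀

-- ψ(q + 2/3 − u) = q³ + u (20/(27q) − u²) for u = 2/(9q) + 20/(81q²), scaled by (81k²N)³.
ψ-at-approximation : ∀ {a k N} → a + lag k N ≡ lead k N →
  let b = 81 * k * k * N ; c = 81 * k * k * k ; w = lag k N in
  ψ⁺ a b + w * w * w ≡ ψ⁻ a b + (c * c * c + 4860 * (k * k * k * (N * N * N)) * w)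
ψ-at-approximation {a} {k} {N} a+w≡y = +-cancelˡ-≡ Z _ _ (begin
  Z + (ψ⁺ a b + w * w * w)
    ≡⟨ swap Z (ψ⁺ a b) (w * w * w) ⟩
  ψ⁺ a b + Z + w * w * w
    ≡⟨ subst (λ y → ψ⁺ a b + Zat y + w * w * w ≡ ψ⁻ a b + (ψ⁺ y b + 4 * w * y * b + 3 * w * w * y)) a+w≡y (ψ-taylor a w b) ⟩
  ψ⁻ a b + (ψ⁺ (lead k N) b + 4 * w * lead k N * b + 3 * w * w * lead k N)
    ≡⟨ cong (ψ⁻ a b +_) (ψ-at-lead k N) ⟩
  ψ⁻ a b + (Z + T)
    ≡⟨ swap′ (ψ⁻ a b) Z T ⟩
  Z + (ψ⁻ a b + T)
    ∎)
  where
  open ≡-Reasoning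
  b = 81 * k * k * N
  w = lag k N
  Zat : ℕ → ℕ
  Zat y = ψ⁻ y b + w * (3 * y * y + 2 * b * b) + 2 * w * w * b
  Z = Zat (lead k N)
  T = 81 * k * k * k * (81 * k * k * k) * (81 * k * k * k) + 4860 * (k * k * k * (N * N * N)) * w
  swap : ∀ z p q → z + (p + q) ≡ p + z + q
  swap = solve-∀
  swap′ : ∀ p z t → p + (z + t) ≡ z + (p + t)
  swap′ = solve-∀

lag-cube-bound : ∀ {k N} → N ≤ k →
  lag k N * lag k N * lag k N + 61488 * (k * k * k * k * (N * N * N * N * N)) ≤ 4860 * (k * k * k * (N * N * N)) * lag k N
lag-cube-bound {k} {N} N≤k = begin
  w * w * w + 61488 * (k * k * k * k * (N * N * N * N * N)) ≡⟨ cong (w * w * w +_) split ⟩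
  w * w * w + 3416 * X * (18 * k * N * N)
    ≤⟨ +-mono-≤ (*-monoˡ-≤ w w²≤) (*-monoʳ-≤ (3416 * X) (m≤m+n (18 * k * N * N) (20 * N * N * N))) ⟩
  1444 * X * w + 3416 * X * w                               ≡⟨ merge X w ⟩
  4860 * X * w                                              ∎
  where
  open ≤-Reasoning
  w = lag k N
  X = k * k * k * (N * N * N)
  regroup : ∀ k N → 18 * (k * k * k * k * (N * N * N * N * N)) ≡ k * k * k * (N * N * N) * (18 * k * N * N)
  regroup = solve-∀
  split : 61488 * (k * k * k * k * (N * N * N * N * N)) ≡ 3416 * X * (18 * k * N * N)
  split = trans (*-assoc 3416 18 (k * k * k * k * (N * N * N * N * N))) (trans (cong (3416 *_) (regroup k N)) (sym (*-assoc 3416 X _)))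
  merge : ∀ X w → 1444 * X * w + 3416 * X * w ≡ 4860 * X * w
  merge = solve-∀
  square : ∀ k N → 38 * (k * N * N) * (38 * (k * N * N)) ≡ 1444 * (k * k * (N * N * N)) * N
  square = solve-∀
  cube : ∀ k N → 1444 * (k * k * (N * N * N)) * k ≡ 1444 * (k * k * k * (N * N * N))
  cube = solve-∀
  collect : ∀ k N → 18 * k * N * N + 20 * k * N * N ≡ 38 * (k * N * N)
  collect = solve-∀
  w≤ : w ≤ 38 * (k * N * N)
  w≤ = ≤-trans (+-monoʳ-≤ (18 * k * N * N) (*-monoˡ-≤ N (*-monoˡ-≤ N (*-monoʳ-≤ 20 N≤k)))) (≤-reflexive (collect k N))
  w²≤ : w * w ≤ 1444 * X
  w²≤ = begin
    w * w                                 ≤⟨ *-mono-≤ w≤ w≤ ⟩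
    38 * (k * N * N) * (38 * (k * N * N)) ≡⟨ square k N ⟩
    1444 * (k * k * (N * N * N)) * N      ≤⟨ *-monoʳ-≤ (1444 * (k * k * (N * N * N))) N≤k ⟩
    1444 * (k * k * (N * N * N)) * k      ≡⟨ cube k N ⟩
    1444 * X                              ∎

ψ-approximation-gap : ∀ {a k N} → N ≤ k → a + lag k N ≡ lead k N →
  let b = 81 * k * k * N ; c = 81 * k * k * k in
  c * c * c + 61488 * (k * k * k * k * (N * N * N * N * N)) + ψ⁻ a b ≤ ψ⁺ a b
ψ-approximation-gap {a} {k} {N} N≤k a+w≡y = +-cancelʳ-≤ (w * w * w) _ _ (begin
  c³ + G + ψ⁻ a b + w * w * w          ≡⟨ rearrange c³ G (ψ⁻ a b) (w * w * w) ⟩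
  ψ⁻ a b + (c³ + (w * w * w + G))      ≤⟨ +-monoʳ-≤ (ψ⁻ a b) (+-monoʳ-≤ c³ (lag-cube-bound N≤k)) ⟩
  ψ⁻ a b + (c³ + 4860 * (k * k * k * (N * N * N)) * w) ≡⟨ ψ-at-approximation {a} {k} {N} a+w≡y ⟨
  ψ⁺ a b + w * w * w                   ∎)
  where
  open ≤-Reasoning
  b = 81 * k * k * N
  w = lag k N
  c³ = 81 * k * k * k * (81 * k * k * k) * (81 * k * k * k)
  G = 61488 * (k * k * k * k * (N * N * N * N * N))
  rearrange : ∀ c g p w → c + g + p + w ≡ p + (c + (w + g))
  rearrange = solve-∀

-- The cost of replacing k by k + 1 in the denominators; m₃ and m₄ stand for k³ and k⁴.
perturbation-bound : ∀ {A β γ C₀ C m₃ m₄} → A ≤ 135 * m₄ → β ≤ 567 * m₃ → γ ≤ 1215 * m₃ → C₀ ≤ C → C ≤ 1296 * m₄ →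
  γ * (C * C + C * C₀ + C₀ * C₀) + 2 * A * A * β ≤ 6142867470 * (m₄ * m₄ * m₃)
perturbation-bound {A} {β} {γ} {C₀} {C} {m₃} {m₄} A≤ β≤ γ≤ C₀≤C C≤ = begin
  γ * (C * C + C * C₀ + C₀ * C₀) + 2 * A * A * β
    ≤⟨ +-mono-≤ (*-monoʳ-≤ γ (+-mono-≤ (+-monoʳ-≤ (C * C) (*-monoʳ-≤ C C₀≤C)) (*-mono-≤ C₀≤C C₀≤C))) ≤-refl ⟩
  γ * (C * C + C * C + C * C) + 2 * A * A * β
    ≤⟨ +-mono-≤ (*-mono-≤ γ≤ (+-mono-≤ (+-mono-≤ C²≤ C²≤) C²≤)) (*-mono-≤ (*-mono-≤ (*-monoʳ-≤ 2 A≤) A≤) β≤) ⟩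
  1215 * m₃ * (D + D + D) + 2 * (135 * m₄) * (135 * m₄) * (567 * m₃)
    ≡⟨ collect 1215 1296 2 135 567 m₃ m₄ ⟩
  6142867470 * (m₄ * m₄ * m₃) ∎
  where
  open ≤-Reasoning
  D = 1296 * m₄ * (1296 * m₄)
  C²≤ : C * C ≤ D
  C²≤ = *-mono-≤ C≤ C≤
  collect : ∀ a b c d f m₃ m₄ → a * m₃ * (b * m₄ * (b * m₄) + b * m₄ * (b * m₄) + b * m₄ * (b * m₄)) + c * (d * m₄) * (d * m₄) * (f * m₃)
                              ≡ (3 * a * b * b + c * d * d * f) * (m₄ * m₄ * m₃)
  collect = solve-∀

slack-absorbs : ∀ {m₃ m₄ n} M c s → M ≤ c * s → s * m₄ ≤ n → M * (m₄ * m₄ * m₃) ≤ m₃ * (c * (m₄ * n))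
slack-absorbs {m₃} {m₄} {n} M c s M≤cs slack = begin
  M * (m₄ * m₄ * m₃)          ≤⟨ *-monoˡ-≤ (m₄ * m₄ * m₃) M≤cs ⟩
  c * s * (m₄ * m₄ * m₃)      ≡⟨ regroup c s m₃ m₄ ⟩
  m₃ * (c * (m₄ * (s * m₄)))  ≤⟨ *-monoʳ-≤ m₃ (*-monoʳ-≤ c (*-monoʳ-≤ m₄ slack)) ⟩
  m₃ * (c * (m₄ * n))         ∎
  where
  open ≤-Reasoning
  regroup : ∀ c s m₃ m₄ → c * s * (m₄ * m₄ * m₃) ≡ m₃ * (c * (m₄ * (s * m₄)))
  regroup = solve-∀

-- Below, A = a k = 81 N⁴ f(q) for the claimed bound f, B = 81 N (k + 1)³ and C = 81 (k + 1)⁴, so that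
-- A/B = f(q)/κ³ and C/B = κ for κ = (k + 1)/N.
module _ {a k N : ℕ} (1≤N : 1 ≤ N) (N≤k : N ≤ k) (a+w≡y : a + lag k N ≡ lead k N) where
  private
    m₃ = k * k * k
    m₄ = k * k * k * k
    b = 81 * k * k * N
    c = 81 * k * k * k
    β = 81 * N * (3 * k * k + 3 * k + 1)
    γ = 81 * (4 * k * k * k + 6 * k * k + 4 * k + 1)
    1≤k = ≤-trans 1≤N N≤k
    open ≤-Reasoning

    B-split : 81 * N * (suc k * suc k * suc k) ≡ b * k + β
    B-split = expanded k N
      where
      expanded : ∀ k N → 81 * N * (suc k * suc k * suc k) ≡ 81 * k * k * N * k + 81 * N * (3 * k * k + 3 * k + 1)
      expanded = solve-∀

    C-split : 81 * (suc k * suc k * suc k * suc k) ≡ c * k + γ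
    C-split = expanded k
      where
      expanded : ∀ k → 81 * (suc k * suc k * suc k * suc k) ≡ 81 * k * k * k * k + 81 * (4 * k * k * k + 6 * k * k + 4 * k + 1)
      expanded = solve-∀

    A≤ : a * k ≤ 135 * m₄
    A≤ = begin
      a * k                                   ≤⟨ *-monoˡ-≤ k (m+o≡n⇒m≤n {a} (lag k N) a+w≡y) ⟩
      lead k N * k                               ≤⟨ *-monoˡ-≤ k (+-monoʳ-≤ (81 * k * k * k) (*-monoʳ-≤ (54 * k * k) N≤k)) ⟩
      (81 * k * k * k + 54 * k * k * k) * k   ≡⟨ collect k ⟩
      135 * m₄                                ∎
      where
      collect : ∀ k → (81 * k * k * k + 54 * k * k * k) * k ≡ 135 * (k * k * k * k)
      collect = solve-∀

    β≤ : β ≤ 567 * m₃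
    β≤ with 1≤k
    ... | s≤s {n = m} _ = begin
      81 * N * (3 * k * k + 3 * k + 1)                    ≤⟨ *-monoˡ-≤ (3 * k * k + 3 * k + 1) (*-monoʳ-≤ 81 N≤k) ⟩
      81 * k * (3 * k * k + 3 * k + 1)                    ≤⟨ *-monoʳ-≤ (81 * k) (m+o≡n⇒m≤n (m * (4 * m + 5)) (grow m)) ⟩
      81 * k * (7 * (k * k))                              ≡⟨ collect k ⟩
      567 * m₃                                            ∎
      where
      grow : ∀ m → let k = suc m in 3 * k * k + 3 * k + 1 + m * (4 * m + 5) ≡ 7 * (k * k)
      grow = solve-∀
      collect : ∀ k → 81 * k * (7 * (k * k)) ≡ 567 * (k * k * k)
      collect = solve-∀

    γ≤ : γ ≤ 1215 * m₃
    γ≤ with 1≤k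
    ... | s≤s {n = m} _ = begin
      81 * (4 * k * k * k + 6 * k * k + 4 * k + 1)
        ≤⟨ *-monoʳ-≤ 81 (m+o≡n⇒m≤n (m * (11 * m * m + 27 * m + 17)) (grow m)) ⟩
      81 * (15 * m₃)                                      ≡⟨ *-assoc 81 15 m₃ ⟨
      1215 * m₃                                           ∎
      where
      grow : ∀ m → let k = suc m in
        4 * k * k * k + 6 * k * k + 4 * k + 1 + m * (11 * m * m + 27 * m + 17) ≡ 15 * (k * k * k)
      grow = solve-∀

    C≤ : c * k + γ ≤ 1296 * m₄
    C≤ = begin
      c * k + γ                 ≤⟨ +-monoʳ-≤ (c * k) γ≤ ⟩
      c * k + 1215 * m₃         ≤⟨ +-monoʳ-≤ (c * k) (*-monoʳ-≤ 1215 (m≤m*n m₃ k)) ⟩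
      c * k + 1215 * (m₃ * k)   ≡⟨ collect k ⟩
      1296 * m₄                 ∎
      where
      instance
        k≢0 : NonZero k
        k≢0 = >-nonZero 1≤k
      collect : ∀ k → 81 * k * k * k * k + 1215 * (k * k * k * k) ≡ 1296 * (k * k * k * k)
      collect = solve-∀

  ψ-above-cube : 1000000 * m₄ ≤ N * N * N * N * N →
    let A = a * k ; B = 81 * N * (suc k * suc k * suc k) ; C = 81 * (suc k * suc k * suc k * suc k) in
    C * C * C + ψ⁻ A B ≤ ψ⁺ A B
  ψ-above-cube slack = begin
    C * C * C + ψ⁻ A B                                      ≡⟨ cong₂ (λ C B → C * C * C + ψ⁻ A B) C-split B-split ⟩
    (c * k + γ) * (c * k + γ) * (c * k + γ) + ψ⁻ A (b * k + β) ≡⟨ expand (c * k) γ A (b * k) β ⟩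
    C₀³ + ψ⁻ A (b * k) + (γ * (C′ * C′ + C′ * (c * k) + c * k * (c * k)) + 2 * A * A * β)
                    ≤⟨ +-monoʳ-≤ (C₀³ + ψ⁻ A (b * k)) (perturbation-bound {m₃ = m₃} {m₄ = m₄} A≤ β≤ γ≤ (m≤m+n (c * k) γ) C≤) ⟩
    C₀³ + ψ⁻ A (b * k) + 6142867470 * (m₄ * m₄ * m₃)        ≤⟨ +-monoʳ-≤ (C₀³ + ψ⁻ A (b * k)) absorbed ⟩
    C₀³ + ψ⁻ A (b * k) + m₃ * G                             ≡⟨ cong (λ p → C₀³ + p + m₃ * G) (ψ⁻-scale a b k) ⟩
    C₀³ + m₃ * ψ⁻ a b + m₃ * G                              ≡⟨ factor c k (ψ⁻ a b) G ⟩
    m₃ * (c * c * c + G + ψ⁻ a b)                           ≤⟨ *-monoʳ-≤ m₃ (ψ-approximation-gap {a} {k} {N} N≤k a+w≡y) ⟩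
    m₃ * ψ⁺ a b                                             ≡⟨ ψ⁺-scale a b k ⟨
    ψ⁺ A (b * k)
      ≤⟨ ψ⁺-monoʳ A (≤-trans (m≤m+n (b * k) β) (≤-reflexive (sym B-split))) ⟩
    ψ⁺ A B                                                  ∎
    where
    A = a * k
    B = 81 * N * (suc k * suc k * suc k)
    C = 81 * (suc k * suc k * suc k * suc k)
    C′ = c * k + γ
    C₀³ = c * k * (c * k) * (c * k)
    G = 61488 * (k * k * k * k * (N * N * N * N * N))
    absorbed : 6142867470 * (m₄ * m₄ * m₃) ≤ m₃ * G
    absorbed = slack-absorbs {m₃} {m₄} {N * N * N * N * N} 6142867470 61488 1000000
                             (≤ᵇ⇒≤ 6142867470 (61488 * 1000000) _) slack
    expand : ∀ C₀ γ A B₀ β → (C₀ + γ) * (C₀ + γ) * (C₀ + γ) + 2 * A * A * (B₀ + β)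
           ≡ C₀ * C₀ * C₀ + 2 * A * A * B₀ + (γ * ((C₀ + γ) * (C₀ + γ) + (C₀ + γ) * C₀ + C₀ * C₀) + 2 * A * A * β)
    expand = solve-∀
    factor : ∀ c k p g → c * k * (c * k) * (c * k) + k * k * k * p + k * k * k * g ≡ k * k * k * (c * c * c + g + p)
    factor = solve-∀

lag≤lead : ∀ {k N} → N ≤ k → lag k N ≤ lead k N
lag≤lead {k} {N} N≤k = begin
  18 * k * N * N + 20 * N * N * N
    ≤⟨ +-mono-≤ (*-mono-≤ (*-monoʳ-≤ (18 * k) N≤k) N≤k) (*-mono-≤ (*-mono-≤ (*-monoʳ-≤ 20 N≤k) N≤k) N≤k) ⟩
  18 * k * k * k + 20 * k * k * k  ≤⟨ m+o≡n⇒m≤n (43 * k * k * k) (collect k) ⟩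
  81 * k * k * k                   ≤⟨ m≤m+n (81 * k * k * k) (54 * k * k * N) ⟩
  lead k N                            ∎
  where
  open ≤-Reasoning
  collect : ∀ k → 18 * k * k * k + 20 * k * k * k + 43 * k * k * k ≡ 81 * k * k * k
  collect = solve-∀

cube-root : ∀ M → Σ ℕ λ k → k * k * k ≤ M × M < suc k * suc k * suc k
cube-root zero = 0 , z≤n , s≤s z≤n
cube-root (suc M) with cube-root M
... | k , k³≤M , M<K³ with suc M <? suc k * suc k * suc k
...   | yes M+1<K³ = k , m≤n⇒m≤1+n k³≤M , M+1<K³
...   | no  M+1≮K³ = suc k , ≤-reflexive (sym M+1≡K³) , subst (_< suc (suc k) * suc (suc k) * suc (suc k)) (sym M+1≡K³) (cube-< (n<1+n (suc k)))
  where
  M+1≡K³ : suc M ≡ suc k * suc k * suc k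
  M+1≡K³ = ≤-antisym M<K³ (≮⇒≥ M+1≮K³)


module _ {v k N : ℕ} (1≤v : 1 ≤ v) (1≤N : 1 ≤ N) (vN³<K³ : v * (N * N * N) < suc k * suc k * suc k) where
  private
    K = suc k
    instance
      v≢0 : NonZero v
      v≢0 = >-nonZero 1≤v
      N³≢0 : NonZero (N * N * N)
      N³≢0 = >-nonZero (cube-≤ 1≤N)

  denominator-≤ : N ≤ k
  denominator-≤ = ≤-pred (cube-cancel-< (≤-<-trans (m≤n*m (N * N * N) v) vN³<K³))

  cube-gap : v * (81 * N * (K * K * K) * (81 * N * (K * K * K)) * (81 * N * (K * K * K)))
             < 81 * (K * K * K * K) * (81 * (K * K * K * K)) * (81 * (K * K * K * K))
  cube-gap = begin-strict
    v * (81 * N * (K * K * K) * (81 * N * (K * K * K)) * (81 * N * (K * K * K))) ≡⟨ split-B v N K ⟩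
    v * (N * N * N) * D                                                       <⟨ *-monoˡ-< D vN³<K³ ⟩
    K * K * K * D                                                             ≡⟨ split-C K ⟩
    81 * (K * K * K * K) * (81 * (K * K * K * K)) * (81 * (K * K * K * K))    ∎
    where
    open ≤-Reasoning
    D = 81 * (K * K * K) * (81 * (K * K * K)) * (81 * (K * K * K))
    split-B : ∀ v N K → v * (81 * N * (K * K * K) * (81 * N * (K * K * K)) * (81 * N * (K * K * K)))
                      ≡ v * (N * N * N) * (81 * (K * K * K) * (81 * (K * K * K)) * (81 * (K * K * K)))
    split-B = solve-∀
    split-C : ∀ K → K * K * K * (81 * (K * K * K) * (81 * (K * K * K)) * (81 * (K * K * K)))
                  ≡ 81 * (K * K * K * K) * (81 * (K * K * K * K)) * (81 * (K * K * K * K))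
    split-C = solve-∀

  numerator-of-ratio : ∀ {e A} → e * (81 * N * (K * K * K)) < A * v → 81 * (N * N * N * N) * e < A
  numerator-of-ratio {e} {A} eB<Av = *-cancelʳ-< (K * K * K) _ _ (begin-strict
    81 * (N * N * N * N) * e * (K * K * K)  ≡⟨ regroup e N K ⟩
    e * (81 * N * (K * K * K)) * (N * N * N) <⟨ *-monoˡ-< (N * N * N) eB<Av ⟩
    A * v * (N * N * N)                     ≡⟨ *-assoc A v (N * N * N) ⟩
    A * (v * (N * N * N))                   ≤⟨ *-monoʳ-≤ A (<⇒≤ vN³<K³) ⟩
    A * (K * K * K)                         ∎)
    where
    open ≤-Reasoning
    regroup : ∀ e N K → 81 * (N * N * N * N) * e * (K * K * K) ≡ e * (81 * N * (K * K * K)) * (N * N * N)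
    regroup = solve-∀

denominator-slack : ∀ c {v k} → 1 ≤ v → let N = c * (v * v) in
  k * k * k ≤ v * (N * N * N) → c * (k * k * k * k) ≤ N * N * N * N * N
denominator-slack c {v} {k} 1≤v k³≤vN³ = begin
  c * (k * k * k * k)               ≤⟨ *-monoʳ-≤ c (*-mono-≤ k³≤vN³ k≤vN) ⟩
  c * (v * (N * N * N) * (v * N))   ≡⟨ regroup c v N ⟩
  N * N * N * N * N                 ∎
  where
  open ≤-Reasoning
  N = c * (v * v)
  instance
    v²≢0 : NonZero (v * v)
    v²≢0 = >-nonZero (*-mono-≤ 1≤v 1≤v)
  regroup : ∀ c v N → c * (v * (N * N * N) * (v * N)) ≡ c * (v * v) * N * N * N * N
  regroup = solve-∀
  cubed : ∀ v N → v * v * v * (N * N * N) ≡ v * N * (v * N) * (v * N)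
  cubed = solve-∀
  k≤vN : k ≤ v * N
  k≤vN = cube-cancel-≤ (begin
    k * k * k                 ≤⟨ k³≤vN³ ⟩
    v * (N * N * N)           ≤⟨ *-monoˡ-≤ (N * N * N) (m≤n*m v (v * v)) ⟩
    v * v * v * (N * N * N)   ≡⟨ cubed v N ⟩
    v * N * (v * N) * (v * N) ∎)

below-bound-scaled : ∀ {v e k N} → 1 ≤ v → 1 ≤ N → CubicBound v e →
  v * (N * N * N) < suc k * suc k * suc k → 1000000 * (k * k * k * k) ≤ N * N * N * N * N →
  81 * (N * N * N * N) * e + (18 * (k * k * N * N) + 20 * (k * N * N * N)) < 81 * (k * k * k * k) + 54 * (k * k * k * N)
below-bound-scaled {v} {e} {k} {N} 1≤v 1≤N cubic vN³<K³ slack = begin-strict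
  81 * (N * N * N * N) * e + (18 * (k * k * N * N) + 20 * (k * N * N * N)) ≡⟨ cong (81 * (N * N * N * N) * e +_) (k*lag k N) ⟨
  81 * (N * N * N * N) * e + k * lag k N  <⟨ +-monoˡ-< (k * lag k N) (numerator-of-ratio {v} {k} {N} 1≤v 1≤N vN³<K³ eB<Av) ⟩
  a * k + k * lag k N                     ≡⟨ factor a k (lag k N) ⟩
  k * (a + lag k N)                       ≡⟨ cong (k *_) a+lag≡lead ⟩
  k * lead k N                            ≡⟨ k*lead k N ⟩
  81 * (k * k * k * k) + 54 * (k * k * k * N) ∎
  where
  open ≤-Reasoning
  N≤k = denominator-≤ {v} {k} {N} 1≤v 1≤N vN³<K³
  a = lead k N ∸ lag k N
  a+lag≡lead : a + lag k N ≡ lead k N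
  a+lag≡lead = m∸n+n≡m (lag≤lead N≤k)
  eB<Av : e * (81 * N * (suc k * suc k * suc k)) < a * k * v
  eB<Av = ratio-< {v} {e} (a * k) (81 * N * (suc k * suc k * suc k)) (81 * (suc k * suc k * suc k * suc k)) 1≤v cubic
                  (cube-gap {v} {k} {N} 1≤v 1≤N vN³<K³) (ψ-above-cube {a} {k} {N} 1≤N N≤k a+lag≡lead slack)
  k*lag : ∀ k N → k * (18 * k * N * N + 20 * N * N * N) ≡ 18 * (k * k * N * N) + 20 * (k * N * N * N)
  k*lag = solve-∀
  k*lead : ∀ k N → k * (81 * k * k * k + 54 * k * k * N) ≡ 81 * (k * k * k * k) + 54 * (k * k * k * N)
  k*lead = solve-∀
  factor : ∀ a k w → a * k + k * w ≡ k * (a + w)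
  factor = solve-∀

-- From ℕ to ℚ

ι : ℕ → ℚ.ℚ
ι m = ℤ.+ m ℚ./ 1

private
  toℚᵘ-ι : ∀ m → ℚ.toℚᵘ (ι m) ℚᵘ.≃ mkℚᵘ (ℤ.+ m) 0
  toℚᵘ-ι m = ℚ.toℚᵘ-fromℚᵘ (mkℚᵘ (ℤ.+ m) 0)

  +m≡+m*1 : ∀ m → ℤ.+ m ≡ ℤ.+ m ℤ.* ℤ.+ 1
  +m≡+m*1 m = sym (ℤ.*-identityʳ (ℤ.+ m))

ι-* : ∀ m n → ι (m * n) ≡ ι m ℚ.* ι n
ι-* m n = ℚ.toℚᵘ-injective (begin
  ℚ.toℚᵘ (ι (m * n))                   ≈⟨ toℚᵘ-ι (m * n) ⟩
  mkℚᵘ (ℤ.+ (m * n)) 0                 ≡⟨ cong (λ z → mkℚᵘ z 0) (ℤ.pos-* m n) ⟩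
  mkℚᵘ (ℤ.+ m) 0 ℚᵘ.* mkℚᵘ (ℤ.+ n) 0       ≈⟨ ℚᵘ.*-cong (toℚᵘ-ι m) (toℚᵘ-ι n) ⟨
  ℚ.toℚᵘ (ι m) ℚᵘ.* ℚ.toℚᵘ (ι n)           ≈⟨ ℚ.toℚᵘ-homo-* (ι m) (ι n) ⟨
  ℚ.toℚᵘ (ι m ℚ.* ι n)                   ∎)
  where open ℚᵘ.≃-Reasoning

ι-+ : ∀ m n → ι (m + n) ≡ ι m ℚ.+ ι n
ι-+ m n = ℚ.toℚᵘ-injective (begin
  ℚ.toℚᵘ (ι (m + n))                   ≈⟨ toℚᵘ-ι (m + n) ⟩
  mkℚᵘ (ℤ.+ (m + n)) 0                 ≡⟨ cong (λ z → mkℚᵘ z 0) (trans (ℤ.pos-+ m n) (cong₂ ℤ._+_ (+m≡+m*1 m) (+m≡+m*1 n))) ⟩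
  mkℚᵘ (ℤ.+ m) 0 ℚᵘ.+ mkℚᵘ (ℤ.+ n) 0       ≈⟨ ℚᵘ.+-cong (toℚᵘ-ι m) (toℚᵘ-ι n) ⟨
  ℚ.toℚᵘ (ι m) ℚᵘ.+ ℚ.toℚᵘ (ι n)           ≈⟨ ℚ.toℚᵘ-homo-+ (ι m) (ι n) ⟨
  ℚ.toℚᵘ (ι m ℚ.+ ι n)                   ∎)
  where open ℚᵘ.≃-Reasoning

ι-mono-< : ∀ {m n} → m < n → ι m ℚ.< ι n
ι-mono-< {m} {n} m<n = ℚ.toℚᵘ-cancel-<
  (ℚᵘ.<-respˡ-≃ (ℚᵘ.≃-sym (toℚᵘ-ι m)) (ℚᵘ.<-respʳ-≃ (ℚᵘ.≃-sym (toℚᵘ-ι n))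
    (*<* (subst₂ ℤ._<_ (+m≡+m*1 m) (+m≡+m*1 n) (ℤ.+<+ m<n)))))

ι-mono-≤ : ∀ {m n} → m ≤ n → ι m ℚ.≤ ι n
ι-mono-≤ {m} {n} m≤n = ℚ.toℚᵘ-cancel-≤
  (ℚᵘ.≤-respˡ-≃ (ℚᵘ.≃-sym (toℚᵘ-ι m)) (ℚᵘ.≤-respʳ-≃ (ℚᵘ.≃-sym (toℚᵘ-ι n))
    (*≤* (subst₂ ℤ._≤_ (+m≡+m*1 m) (+m≡+m*1 n) (ℤ.+≤+ m≤n)))))

ι-*₃ : ∀ a b c → ι (a * b * c) ≡ ι a ℚ.* ι b ℚ.* ι c
ι-*₃ a b c = trans (ι-* (a * b) c) (cong (ℚ._* ι c) (ι-* a b))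

ι-*₄ : ∀ a b c d → ι (a * b * c * d) ≡ ι a ℚ.* ι b ℚ.* ι c ℚ.* ι d
ι-*₄ a b c d = trans (ι-* (a * b * c) d) (cong (ℚ._* ι d) (ι-*₃ a b c))

ι-scaled₄ : ∀ s a b c d → ι (s * (a * b * c * d)) ≡ ι s ℚ.* (ι a ℚ.* ι b ℚ.* ι c ℚ.* ι d)
ι-scaled₄ s a b c d = trans (ι-* s _) (cong (ι s ℚ.*_) (ι-*₄ a b c d))

/-*-cancel : ∀ k N .{{_ : NonZero N}} → (ℤ.+ k ℚ./ N) ℚ.* ι N ≡ ι k
/-*-cancel k N@(suc N-1) = ℚ.toℚᵘ-injective (begin
  ℚ.toℚᵘ (ℤ.+ k ℚ./ N ℚ.* ι N)                  ≈⟨ ℚ.toℚᵘ-homo-* (ℤ.+ k ℚ./ N) (ι N) ⟩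
  ℚ.toℚᵘ (ℤ.+ k ℚ./ N) ℚᵘ.* ℚ.toℚᵘ (ι N)          ≈⟨ ℚᵘ.*-cong (ℚ.toℚᵘ-fromℚᵘ (mkℚᵘ (ℤ.+ k) N-1)) (toℚᵘ-ι N) ⟩
  mkℚᵘ (ℤ.+ k) N-1 ℚᵘ.* mkℚᵘ (ℤ.+ N) 0
    ≈⟨ ℚᵘ.*≡* (trans (ℤ.*-identityʳ _) (cong (λ m → ℤ.+ k ℤ.* ℤ.+ suc m) (sym (*-identityʳ N-1)))) ⟩
  mkℚᵘ (ℤ.+ k) 0                            ≈⟨ toℚᵘ-ι k ⟨
  ℚ.toℚᵘ (ι k)                              ∎)
  where open ℚᵘ.≃-Reasoning

private
  module S = +-*-Solver

  bound-scaled : ∀ x n → let m = x ℚ.* n in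
    bound x ℚ.* (ι 81 ℚ.* (n ℚ.* n ℚ.* n ℚ.* n))
    ≡ (ι 81 ℚ.* (m ℚ.* m ℚ.* m ℚ.* m) ℚ.+ ι 54 ℚ.* (m ℚ.* m ℚ.* m ℚ.* n))
      ℚ.- (ι 18 ℚ.* (m ℚ.* m ℚ.* n ℚ.* n) ℚ.+ ι 20 ℚ.* (m ℚ.* n ℚ.* n ℚ.* n))
  bound-scaled = S.solve 2 (λ x n →
      (x :* x :* x :* x :+ con (ℤ.+ 2 ℚ./ 3) :* (x :* x :* x) :- con (ℤ.+ 2 ℚ./ 9) :* (x :* x) :- con (ℤ.+ 20 ℚ./ 81) :* x)
        :* (con (ι 81) :* (n :* n :* n :* n))
    := (con (ι 81) :* ((x :* n) :* (x :* n) :* (x :* n) :* (x :* n)) :+ con (ι 54) :* ((x :* n) :* (x :* n) :* (x :* n) :* n))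
        :- (con (ι 18) :* ((x :* n) :* (x :* n) :* n :* n) :+ con (ι 20) :* ((x :* n) :* n :* n :* n))) refl
    where open S

  +<⇒<- : ∀ {a b c} → a ℚ.+ b ℚ.< c → a ℚ.< c ℚ.- b
  +<⇒<- {a} {b} {c} a+b<c = subst (ℚ._< c ℚ.- b) (cancel a b) (ℚ.+-monoˡ-< (ℚ.- b) a+b<c)
    where
    cancel : ∀ a b → a ℚ.+ b ℚ.- b ≡ a
    cancel = S.solve 2 (λ a b → a S.:+ b S.:- b S.:= a) refl

below-bound-of-ℕ : ∀ e k N .{{_ : NonZero N}} →
  81 * (N * N * N * N) * e + (18 * (k * k * N * N) + 20 * (k * N * N * N))
    < 81 * (k * k * k * k) + 54 * (k * k * k * N) →
  ι e ℚ.< bound (ℤ.+ k ℚ./ N)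
below-bound-of-ℕ e k N ineq = ℚ.*-cancelʳ-<-nonNeg (ι (81 * (N * N * N * N))) {{ℚ.normalize-nonNeg (81 * (N * N * N * N)) 1}}
  (subst₂ ℚ._<_ (ℚ.*-comm d (ι e)) (sym scaled) (+<⇒<- (subst₂ ℚ._<_ lhs rhs (ι-mono-< ineq))))
  where
  x = ℤ.+ k ℚ./ N
  n = ι N
  d = ι (81 * (N * N * N * N))
  lhs : ι (81 * (N * N * N * N) * e + (18 * (k * k * N * N) + 20 * (k * N * N * N)))
      ≡ d ℚ.* ι e ℚ.+ (ι 18 ℚ.* (ι k ℚ.* ι k ℚ.* n ℚ.* n) ℚ.+ ι 20 ℚ.* (ι k ℚ.* n ℚ.* n ℚ.* n))
  lhs = trans (ι-+ (81 * (N * N * N * N) * e) _)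
              (cong₂ ℚ._+_ (ι-* (81 * (N * N * N * N)) e)
                           (trans (ι-+ (18 * (k * k * N * N)) _) (cong₂ ℚ._+_ (ι-scaled₄ 18 k k N N) (ι-scaled₄ 20 k N N N))))
  rhs : ι (81 * (k * k * k * k) + 54 * (k * k * k * N))
      ≡ ι 81 ℚ.* (ι k ℚ.* ι k ℚ.* ι k ℚ.* ι k) ℚ.+ ι 54 ℚ.* (ι k ℚ.* ι k ℚ.* ι k ℚ.* n)
  rhs = trans (ι-+ (81 * (k * k * k * k)) _) (cong₂ ℚ._+_ (ι-scaled₄ 81 k k k k) (ι-scaled₄ 54 k k k N))
  scaled : bound x ℚ.* d ≡ (ι 81 ℚ.* (ι k ℚ.* ι k ℚ.* ι k ℚ.* ι k) ℚ.+ ι 54 ℚ.* (ι k ℚ.* ι k ℚ.* ι k ℚ.* n))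
                           ℚ.- (ι 18 ℚ.* (ι k ℚ.* ι k ℚ.* n ℚ.* n) ℚ.+ ι 20 ℚ.* (ι k ℚ.* n ℚ.* n ℚ.* n))
  scaled = trans (cong (bound x ℚ.*_) (ι-scaled₄ 81 N N N N))
                 (subst (λ m → bound x ℚ.* (ι 81 ℚ.* (n ℚ.* n ℚ.* n ℚ.* n))
                               ≡ (ι 81 ℚ.* (m ℚ.* m ℚ.* m ℚ.* m) ℚ.+ ι 54 ℚ.* (m ℚ.* m ℚ.* m ℚ.* n))
                                 ℚ.- (ι 18 ℚ.* (m ℚ.* m ℚ.* n ℚ.* n) ℚ.+ ι 20 ℚ.* (m ℚ.* n ℚ.* n ℚ.* n)))
                        (/-*-cancel k N) (bound-scaled x n))

cube-≤-of-ℕ : ∀ v k N .{{_ : NonZero N}} → k * k * k ≤ v * (N * N * N) →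
  (ℤ.+ k ℚ./ N) ℚ.* (ℤ.+ k ℚ./ N) ℚ.* (ℤ.+ k ℚ./ N) ℚ.≤ ι v
cube-≤-of-ℕ v k N k³≤vN³ = ℚ.*-cancelʳ-≤-pos (ι (N * N * N)) {{ℚ.normalize-pos (N * N * N) 1 {{_}} {{N³≢0}}}}
  (subst₂ ℚ._≤_ lhs (ι-* v (N * N * N)) (ι-mono-≤ k³≤vN³))
  where
  x = ℤ.+ k ℚ./ N
  n = ι N
  N³≢0 : NonZero (N * N * N)
  N³≢0 = m*n≢0 (N * N) N {{m*n≢0 N N}}
  cube : ∀ x n → x ℚ.* x ℚ.* x ℚ.* (n ℚ.* n ℚ.* n) ≡ (x ℚ.* n) ℚ.* (x ℚ.* n) ℚ.* (x ℚ.* n)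
  cube = S.solve 2 (λ x n → x S.:* x S.:* x S.:* (n S.:* n S.:* n) S.:= (x S.:* n) S.:* (x S.:* n) S.:* (x S.:* n)) refl
  lhs : ι (k * k * k) ≡ x ℚ.* x ℚ.* x ℚ.* ι (N * N * N)
  lhs = trans (ι-*₃ k k k) (sym (trans (cong (x ℚ.* x ℚ.* x ℚ.*_) (ι-*₃ N N N))
                                        (trans (cube x n) (cong (λ m → m ℚ.* m ℚ.* m) (/-*-cancel k N)))))

-- The constant c in the denominator N = c v² is a variable rather than the literal 10⁶, which Agda would
-- otherwise unfold in unification.
below-bound-of-cubic : ∀ {v e} c → 1000000 ≤ c → 1 ≤ v → CubicBound v e → BelowBoundAtCubeRoot e v
below-bound-of-cubic {v} {e} c 10⁶≤c 1≤v cubic with cube-root (v * (c * (v * v) * (c * (v * v)) * (c * (v * v))))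
... | k , k³≤vN³ , vN³<K³ =
  ℤ.+ k ℚ./ N , ℚ.nonNegative⁻¹ (ℤ.+ k ℚ./ N) {{ℚ.normalize-nonNeg k N}} , cube-≤-of-ℕ v k N k³≤vN³ ,
  below-bound-of-ℕ e k N (below-bound-scaled {v} {e} {k} {N} 1≤v 1≤N cubic vN³<K³ slack)
  where
  N = c * (v * v)
  1≤N : 1 ≤ N
  1≤N = *-mono-≤ (≤-trans (≤ᵇ⇒≤ 1 1000000 _) 10⁶≤c) (*-mono-≤ 1≤v 1≤v)
  instance
    N≢0 : NonZero N
    N≢0 = >-nonZero 1≤N
  slack : 1000000 * (k * k * k * k) ≤ N * N * N * N * N
  slack = ≤-trans (*-monoˡ-≤ (k * k * k * k) 10⁶≤c) (denominator-slack c {v} {k} 1≤v k³≤vN³)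

corollary4p9 : (v e : ℕ) (R : Fin v → Fin v → Bool) → 1 ≤ v →
    edgeCount v R ≡ e → GirthAtLeast (bipGraph R) 8 →
    BelowBoundAtCubeRoot e v
corollary4p9 v e R 1≤v refl girth = below-bound-of-cubic {v} {edgeCount v R} 1000000 ≤-refl 1≤v (girth-eight-cubic R 1≤v girth)
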